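{- Every C-recursive sequence of natural numbers is a Kalmar function.
   Context: Natural numbers are the non-negative integers, and sequences are indexed by $n\ge 0$. A sequence $s(n)$ of natural numbers is C-recursive if there exist an integer $d\ge 1$ and rational numbers $\alpha_1,\dots,\alpha_d$ with $\alpha_d\ne 0$ such that $s(n+d)+\alpha_1 s(n+d-1)+\dots+\alpha_d s(n)=0$ for every integer $n\ge 0$. A (univariate) Kalmar function is a computable sequence of natural numbers $f(n)$ for which there is a fixed $k\ge 0$ such that the deterministic computation time of $f(n)$ on input $n$ is upper-bounded by the iterated exponential $2^{2^{\cdot^{\cdot^{2^n}}}}$ with $k$ twos. -}

module Defs where

open import Data.Nat using (ℕ; zero; suc; _+_; _∸_; _^_; _≤_; _<ᵇ_)
open import Data.Bool using (if_then_else_)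
open import Data.Fin using (Fin; toℕ; fromℕ)
import Data.Fin as F
open import Data.Vec using (Vec; lookup; _[_]≔_; replicate; _∷_; [])
open import Data.Product using (Σ; _×_; _,_; ∃)
open import Data.Integer using (+_)
open import Data.Rational using (ℚ; _/_; 0ℚ) renaming (_+_ to _+ℚ_; _*_ to _*ℚ_)
open import Relation.Binary.PropositionalEquality using (_≡_; _≢_)

ℕ→ℚ : ℕ → ℚ
ℕ→ℚ n = + n / 1

sumℚ : ∀ {d} → (Fin d → ℚ) → ℚ
sumℚ {zero}  f = 0ℚ
sumℚ {suc d} f = f F.zero +ℚ sumℚ (λ i → f (F.suc i))

-- s is C-recursive: there are d ≥ 1 (written d = suc e) and rationals
-- α₁,…,α_d (α i stands for α_{i+1}) with α_d ≠ 0 such that for all n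
--   s(n+d) + α₁ s(n+d-1) + … + α_d s(n) = 0 .
CRecursive : (ℕ → ℕ) → Set
CRecursive s =
  Σ ℕ λ e → let d = suc e in
  Σ (Fin d → ℚ) λ α →
    (α (fromℕ e) ≢ 0ℚ) ×
    (∀ n → ℕ→ℚ (s (n + d))
             +ℚ sumℚ (λ i → α i *ℚ ℕ→ℚ (s (n + d ∸ suc (toℕ i))))
           ≡ 0ℚ)

-- Machine model: deterministic register machines (Shepherdson–Sturgis /
-- Minsky style) with r registers holding natural numbers.

data Instr (r : ℕ) : Set where
  inc : (x : Fin r) (l : ℕ) → Instr r
  dec : (x : Fin r) (l₀ l₁ : ℕ) → Instr r

-- a program is a list of L instructions; any program counter ≥ L means "halted"
Program : ℕ → ℕ → Set
Program r L = Vec (Instr r) L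

record Config (r : ℕ) : Set where
  constructor ⟨_,_⟩
  field
    pc   : ℕ
    regs : Vec ℕ r
open Config public

execInstr : ∀ {r} → Instr r → Vec ℕ r → Config r
execInstr (inc x l) v = ⟨ l , v [ x ]≔ suc (lookup v x) ⟩
execInstr (dec x l₀ l₁) v with lookup v x
... | zero  = ⟨ l₀ , v ⟩
... | suc m = ⟨ l₁ , v [ x ]≔ m ⟩

fetch : ∀ {r L} → Program r L → ℕ → (Instr r → Config r) → Config r → Config r
fetch {L = zero}  []       pc k c = c
fetch {L = suc L} (i ∷ is) zero k c = k i
fetch {L = suc L} (i ∷ is) (suc pc) k c = fetch is pc k c

-- one computation step (a halted configuration is left unchanged)
step : ∀ {r L} → Program r L → Config r → Config r
step P c = fetch P (pc c) (λ i → execInstr i (regs c)) c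

run : ∀ {r L} → Program r L → ℕ → Config r → Config r
run P zero    c = c
run P (suc t) c = run P t (step P c)

Halted : ∀ {r L} → Program r L → Config r → Set
Halted {L = L} P c = L Data.Nat.≤ pc c

initial : ∀ {r} → ℕ → Config (suc r)
initial {r} n = ⟨ 0 , n ∷ replicate r 0 ⟩

output : ∀ {r} → Config (suc r) → ℕ
output c = lookup (regs c) F.zero

tower : ℕ → ℕ → ℕ
tower zero    n = n
tower (suc k) n = 2 ^ tower k n

Kalmar : (ℕ → ℕ) → Set
Kalmar f =
  Σ ℕ λ r → Σ ℕ λ L → Σ (Program (suc r) L) λ P → Σ ℕ λ k →
    ∀ n → Σ ℕ λ t →
      (t ≤ tower k n) ×
      Halted P (run P t (initial n)) ×
      (output (run P t (initial n)) ≡ f n)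

-- Clearing denominators turns the recurrence into D·s(k+d) + B(k) = A(k), where A(k) and B(k) are
-- fixed combinations with coefficients in ℕ of the window s(k), …, s(k+d-1). A register machine
-- keeps the window in registers and, n times, accumulates A(k) and B(k) by repeated transfers,
-- computes s(k+d) = (A(k) ∸ B(k)) / D by repeated decrements, and shifts the window; then it
-- outputs s(n). All values involved are at most G·Q^(k+d), where Q - 1 is the sum of the
-- coefficients of A, so the run takes O((n+1)·Qⁿ) ≤ 2^(c + (Q+1)·n) steps, which is bounded by a
-- tower of fixed height.

module Submission where

open import Defs
import Algebra.Properties.Semiring.Sum
open import Data.Empty using (⊥-elim)
open import Data.Fin as Fin using (Fin; toℕ; _≟_)
import Data.Fin.Properties as FinP
open import Data.List as List using (List; []; _∷_; _++_; length; replicate)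
import Data.List.Properties as ListP
open import Data.Nat as ℕ using (ℕ; zero; suc; _+_; _*_; _∸_; _/_; _^_; _≤_; _<_; z≤n; s≤s)
import Data.Nat.DivMod as DM
open import Data.Nat.Induction using (<-rec)
import Data.Nat.Properties as ℕP
open import Data.Nat.Tactic.RingSolver using (solve; solve-∀)
open import Data.Product using (Σ; _×_; _,_)
open import Data.Rational using (ℚ; 0ℚ; toℚᵘ) renaming (_+_ to _+ℚ_; _*_ to _*ℚ_)
import Data.Rational as ℚ
import Data.Rational.Properties as ℚP
open import Data.Sum using (_⊎_; inj₁; inj₂)
open import Data.Vec as Vec using (Vec; lookup)
open import Data.Vec.Functional using (updateAt)
import Data.Vec.Functional.Properties as VecFP
import Data.Vec.Properties as VecP
open import Function using (_∘_; const)
open import Function.Definitions using (Injective)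
open import Relation.Binary.PropositionalEquality
open import Relation.Nullary using (yes; no)

open Algebra.Properties.Semiring.Sum ℕP.+-*-semiring using (sum; sum-cong-≗; *-distribʳ-sum; *-distribˡ-sum)

sum-mono-≤ : ∀ {n} {f g : Fin n → ℕ} → (∀ i → f i ≤ g i) → sum f ≤ sum g
sum-mono-≤ {zero}  f≤g = z≤n
sum-mono-≤ {suc n} f≤g = ℕP.+-mono-≤ (f≤g Fin.zero) (sum-mono-≤ (λ i → f≤g (Fin.suc i)))

lookup≤sum : ∀ {n} (f : Fin n → ℕ) i → f i ≤ sum f
lookup≤sum f Fin.zero    = ℕP.m≤m+n _ _
lookup≤sum f (Fin.suc i) = ℕP.≤-trans (lookup≤sum (λ j → f (Fin.suc j)) i) (ℕP.m≤n+m _ (f Fin.zero))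

sum-const : ∀ n c → sum {n} (λ _ → c) ≡ n * c
sum-const zero    c = refl
sum-const (suc n) c = cong (c +_) (sum-const n c)

last-or-inject₁ : ∀ {e} (i : Fin (suc e)) → i ≡ Fin.fromℕ e ⊎ Σ (Fin e) λ j → i ≡ Fin.inject₁ j
last-or-inject₁ {zero}  Fin.zero    = inj₁ refl
last-or-inject₁ {suc e} Fin.zero    = inj₂ (Fin.zero , refl)
last-or-inject₁ {suc e} (Fin.suc i) with last-or-inject₁ i
... | inj₁ refl       = inj₁ refl
... | inj₂ (j , refl) = inj₂ (Fin.suc j , refl)

n<2^n : ∀ n → n < 2 ^ n
n<2^n zero    = s≤s z≤n
n<2^n (suc n) = ℕP.+-mono-≤ (ℕP.m^n>0 2 n) (ℕP.≤-trans (n<2^n n) (ℕP.m≤m+n (2 ^ n) 0))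

2*n≤2^n : ∀ n → 2 * n ≤ 2 ^ n
2*n≤2^n zero          = z≤n
2*n≤2^n (suc zero)    = ℕP.≤-refl
2*n≤2^n (suc (suc n)) = ℕP.*-monoʳ-≤ 2 (ℕP.≤-trans 2+n≤2*[1+n] (2*n≤2^n (suc n)))
  where
  2+n≤2*[1+n] : 2 + n ≤ 2 * suc n
  2+n≤2*[1+n] = ℕP.≤-trans (ℕP.m≤m+n (2 + n) n) (ℕP.≤-reflexive (solve (n ∷ [])))

height+n≤tower : ∀ k n → k + n ≤ tower k n
height+n≤tower zero    n = ℕP.≤-refl
height+n≤tower (suc k) n = ℕP.≤-trans (s≤s (height+n≤tower k n)) (n<2^n (tower k n))

2^i*tower≤tower : ∀ i k n → 2 ^ i * tower k n ≤ tower (i + k) n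
2^i*tower≤tower zero    k n = ℕP.≤-reflexive (ℕP.+-identityʳ (tower k n))
2^i*tower≤tower (suc i) k n = begin
  2 ^ suc i * tower k n     ≡⟨ ℕP.*-assoc 2 (2 ^ i) (tower k n) ⟩
  2 * (2 ^ i * tower k n)   ≤⟨ ℕP.*-monoʳ-≤ 2 (2^i*tower≤tower i k n) ⟩
  2 * tower (i + k) n       ≤⟨ 2*n≤2^n (tower (i + k) n) ⟩
  tower (suc i + k) n       ∎
  where open ℕP.≤-Reasoning

linear≤tower : ∀ c a n → c + suc a * n ≤ tower (suc a + c) n
linear≤tower c a n = begin
  c + suc a * n             ≤⟨ ℕP.+-monoˡ-≤ (suc a * n) (ℕP.m≤n*m c (suc a)) ⟩
  suc a * c + suc a * n     ≡⟨ ℕP.*-distribˡ-+ (suc a) c n ⟨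
  suc a * (c + n)           ≤⟨ ℕP.*-mono-≤ (ℕP.<⇒≤ (n<2^n (suc a))) (height+n≤tower c n) ⟩
  2 ^ suc a * tower c n     ≤⟨ 2^i*tower≤tower (suc a) c n ⟩
  tower (suc a + c) n       ∎
  where open ℕP.≤-Reasoning

poly*exp≤tower : ∀ c q n → c * (suc n * q ^ n) ≤ tower (suc (suc q + c)) n
poly*exp≤tower c q n = begin
  c * (suc n * q ^ n)             ≤⟨ ℕP.*-mono-≤ (ℕP.<⇒≤ (n<2^n c))
                                       (ℕP.*-mono-≤ (n<2^n n) (ℕP.^-monoˡ-≤ n (ℕP.<⇒≤ (n<2^n q)))) ⟩
  2 ^ c * (2 ^ n * (2 ^ q) ^ n)   ≡⟨ cong (λ m → 2 ^ c * (2 ^ n * m)) (ℕP.^-*-assoc 2 q n) ⟩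
  2 ^ c * (2 ^ n * 2 ^ (q * n))   ≡⟨ cong (2 ^ c *_) (ℕP.^-distribˡ-+-* 2 n (q * n)) ⟨
  2 ^ c * 2 ^ (suc q * n)         ≡⟨ ℕP.^-distribˡ-+-* 2 c (suc q * n) ⟨
  2 ^ (c + suc q * n)             ≤⟨ ℕP.^-monoʳ-≤ 2 (linear≤tower c q n) ⟩
  tower (suc (suc q + c)) n       ∎
  where open ℕP.≤-Reasoning

affine≤ : ∀ {x c w} a b → x ≤ c * w → x * a + b ≤ (w + 1) * (c * a + b)
affine≤ {x} {c} {w} a b x≤cw = ℕP.≤-trans (ℕP.+-monoˡ-≤ b (ℕP.*-monoˡ-≤ a x≤cw))
  (ℕP.≤-trans (ℕP.m≤m+n (c * w * a + b) (w * b + c * a)) (ℕP.≤-reflexive (expand c w a b)))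
  where
  expand : ∀ c w a b → c * w * a + b + (w * b + c * a) ≡ (w + 1) * (c * a + b)
  expand = solve-∀

recurrence-index-< : ∀ e k (i : Fin (suc e)) → k + suc e ∸ suc (toℕ i) < k + suc e
recurrence-index-< e k i = ℕP.∸-monoʳ-< {o = 0} (s≤s z≤n) (ℕP.≤-trans (FinP.toℕ<n i) (ℕP.m≤n+m (suc e) k))

module _ (s : ℕ → ℕ) (e : ℕ) (c : Fin (suc e) → ℕ)
         (s-bounded : ∀ k → s (k + suc e) ≤ sum (λ i → c i * s (k + suc e ∸ suc (toℕ i))))
         where

  private
    d = suc e
    G = suc (sum {d} (λ i → s (toℕ i)))
    Q = suc (sum c)

    initial-bound : ∀ m → m < d → s m ≤ G * Q ^ m
    initial-bound m m<d = begin
      s m                          ≡⟨ cong s (FinP.toℕ-fromℕ< m<d) ⟨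
      s (toℕ (Fin.fromℕ< m<d))     ≤⟨ lookup≤sum (λ i → s (toℕ i)) (Fin.fromℕ< m<d) ⟩
      sum {d} (λ i → s (toℕ i))    <⟨ ℕP.n<1+n _ ⟩
      G                            ≤⟨ ℕP.m≤m*n G (Q ^ m) {{ℕ.>-nonZero (ℕP.m^n>0 Q m)}} ⟩
      G * Q ^ m                    ∎
      where open ℕP.≤-Reasoning

    step-bound : ∀ k → (∀ {j} → j < k + d → s j ≤ G * Q ^ j) → s (k + d) ≤ G * Q ^ (k + d)
    step-bound k rec = begin
      s (k + d)                                 ≤⟨ s-bounded k ⟩
      sum (λ i → c i * s (index i))             ≤⟨ sum-mono-≤ (λ i → ℕP.*-monoʳ-≤ (c i) (earlier-bound i)) ⟩
      sum (λ i → c i * (G * Q ^ (k + e)))       ≡⟨ *-distribʳ-sum (G * Q ^ (k + e)) c ⟨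
      sum c * (G * Q ^ (k + e))                 ≤⟨ ℕP.*-monoˡ-≤ (G * Q ^ (k + e)) (ℕP.n≤1+n (sum c)) ⟩
      Q * (G * Q ^ (k + e))                     ≡⟨ rearrange Q G (Q ^ (k + e)) ⟩
      G * Q ^ suc (k + e)                       ≡⟨ cong (λ m → G * Q ^ m) (ℕP.+-suc k e) ⟨
      G * Q ^ (k + d)                           ∎
      where
      open ℕP.≤-Reasoning
      index : Fin d → ℕ
      index i = k + d ∸ suc (toℕ i)
      earlier-bound : ∀ i → s (index i) ≤ G * Q ^ (k + e)
      earlier-bound i = ℕP.≤-trans (rec (recurrence-index-< e k i))
        (ℕP.*-monoʳ-≤ G (ℕP.^-monoʳ-≤ Q (ℕP.≤-pred (subst (index i <_) (ℕP.+-suc k e) (recurrence-index-< e k i)))))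
      rearrange : ∀ q g x → q * (g * x) ≡ g * (q * x)
      rearrange = solve-∀

  recurrence-growth : ∀ m → s m ≤ G * Q ^ m
  recurrence-growth = <-rec (λ m → s m ≤ G * Q ^ m) bound
    where
    bound : ∀ m → (∀ {j} → j < m → s j ≤ G * Q ^ j) → s m ≤ G * Q ^ m
    bound m rec with m ℕ.<? d
    ... | yes m<d = initial-bound m m<d
    ... | no m≮d = subst (λ j → s j ≤ G * Q ^ j) (ℕP.m∸n+n≡m d≤m)
                     (step-bound (m ∸ d) (λ j< → rec (subst (_ <_) (ℕP.m∸n+n≡m d≤m) j<)))
      where d≤m = ℕP.≮⇒≥ m≮d

module Denominators where
  open import Data.Integer as ℤ using (ℤ; +_; -[1+_])
  import Data.Integer.Properties as ℤP
  open import Data.Integer.Tactic.RingSolver using () renaming (solve-∀ to ℤ-solve-∀)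
  open import Data.Rational.Unnormalised as ℚᵘ using (mkℚᵘ; _≃_)
  import Data.Rational.Unnormalised.Properties as ℚᵘP
  module ℤΣ = Algebra.Properties.Semiring.Sum ℤP.+-*-semiring

  posPart negPart : ℤ → ℕ
  posPart (+ n)    = n
  posPart -[1+ n ] = 0
  negPart (+ n)    = 0
  negPart -[1+ n ] = suc n

  posPart-negPart : ∀ c → c ≡ + posPart c ℤ.- + negPart c
  posPart-negPart (+ n)    = sym (ℤP.+-identityʳ (+ n))
  posPart-negPart -[1+ n ] = refl

  sum-posPart-negPart : ∀ {d} (c : Fin d → ℤ) (y : Fin d → ℕ) →
    ℤΣ.sum (λ i → c i ℤ.* + y i)
      ≡ + sum (λ i → posPart (c i) ℕ.* y i) ℤ.- + sum (λ i → negPart (c i) ℕ.* y i)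
  sum-posPart-negPart {zero}  c y = refl
  sum-posPart-negPart {suc d} c y = begin
    c₀ ℤ.* + y₀ ℤ.+ ℤΣ.sum (λ i → c (Fin.suc i) ℤ.* + y (Fin.suc i))
      ≡⟨ cong₂ (λ a b → a ℤ.* + y₀ ℤ.+ b) (posPart-negPart c₀) (sum-posPart-negPart (λ i → c (Fin.suc i)) (λ i → y (Fin.suc i))) ⟩
    (+ p ℤ.- + n) ℤ.* + y₀ ℤ.+ (+ P ℤ.- + N)
      ≡⟨ regroup (+ p) (+ n) (+ y₀) (+ P) (+ N) ⟩
    (+ p ℤ.* + y₀ ℤ.+ + P) ℤ.- (+ n ℤ.* + y₀ ℤ.+ + N)
      ≡⟨ cong₂ ℤ._-_ (pos-*-+ p y₀ P) (pos-*-+ n y₀ N) ⟨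
    + (p ℕ.* y₀ ℕ.+ P) ℤ.- + (n ℕ.* y₀ ℕ.+ N) ∎
    where
    open ≡-Reasoning
    c₀ = c Fin.zero
    y₀ = y Fin.zero
    p = posPart c₀
    n = negPart c₀
    P = sum (λ i → posPart (c (Fin.suc i)) ℕ.* y (Fin.suc i))
    N = sum (λ i → negPart (c (Fin.suc i)) ℕ.* y (Fin.suc i))
    regroup : ∀ p n y P N → (p ℤ.- n) ℤ.* y ℤ.+ (P ℤ.- N) ≡ (p ℤ.* y ℤ.+ P) ℤ.- (n ℤ.* y ℤ.+ N)
    regroup = ℤ-solve-∀
    pos-*-+ : ∀ a b c → + (a ℕ.* b ℕ.+ c) ≡ + a ℤ.* + b ℤ.+ + c
    pos-*-+ a b c = trans (ℤP.pos-+ (a ℕ.* b) c) (cong (ℤ._+ + c) (ℤP.pos-* a b))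

  record ClearedDenominators {d} (α : Fin d → ℚ) : Set where
    field
      denominator-1 : ℕ
      numerator     : Fin d → ℤ
      cleared       : ∀ (y : Fin d → ℕ) → toℚᵘ (sumℚ (λ i → α i *ℚ ℕ→ℚ (y i)))
                            ≃ mkℚᵘ (ℤΣ.sum (λ i → numerator i ℤ.* + y i)) denominator-1

  toℚᵘ-as-fraction : ∀ q → toℚᵘ q ≡ mkℚᵘ (ℚ.numerator q) (ℚ.denominator-1 q)
  toℚᵘ-as-fraction (ℚ.mkℚ _ _ _) = refl

  toℚᵘ-ℕ→ℚ : ∀ n → toℚᵘ (ℕ→ℚ n) ≃ mkℚᵘ (+ n) 0
  toℚᵘ-ℕ→ℚ n = ℚP.toℚᵘ-fromℚᵘ (mkℚᵘ (+ n) 0)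

  sum-*ʳ-assoc : ∀ {d} (c y : Fin d → ℤ) k →
    ℤΣ.sum (λ i → (c i ℤ.* k) ℤ.* y i) ≡ ℤΣ.sum (λ i → c i ℤ.* y i) ℤ.* k
  sum-*ʳ-assoc c y k = trans (ℤΣ.sum-cong-≗ (λ i → swap (c i) k (y i))) (sym (ℤΣ.*-distribʳ-sum k (λ i → c i ℤ.* y i)))
    where
    swap : ∀ a b c → (a ℤ.* b) ℤ.* c ≡ (a ℤ.* c) ℤ.* b
    swap = ℤ-solve-∀

  toℚᵘ-*-ℕ→ℚ : ∀ q y → toℚᵘ (q *ℚ ℕ→ℚ y) ≃ mkℚᵘ (ℚ.numerator q) (ℚ.denominator-1 q) ℚᵘ.* mkℚᵘ (+ y) 0
  toℚᵘ-*-ℕ→ℚ q y = ℚᵘP.≃-trans (ℚP.toℚᵘ-homo-* q (ℕ→ℚ y))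
                                (ℚᵘP.*-cong (ℚᵘP.≃-reflexive (toℚᵘ-as-fraction q)) (toℚᵘ-ℕ→ℚ y))

  cleared-cons : ∀ {d} (α : Fin (suc d) → ℚ) → ClearedDenominators (α ∘ Fin.suc) → ClearedDenominators α
  cleared-cons {d} α cleared-tail = record
    { denominator-1 = denominator-1′
    ; numerator     = numerator′
    ; cleared       = cleared′
    }
    where
    open ClearedDenominators cleared-tail renaming (denominator-1 to D'; numerator to c; cleared to tail≃)
    n = ℚ.numerator (α Fin.zero)
    m = ℚ.denominator-1 (α Fin.zero)

    -- the denominator (m+1)·1·(D'+1) that ℚᵘ arithmetic produces for n/(m+1) · y/1 + S/(D'+1), minus one
    denominator-1′ : ℕ
    denominator-1′ = D' ℕ.+ m ℕ.* 1 ℕ.* suc D'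

    numerator′ : Fin (suc d) → ℤ
    numerator′ Fin.zero    = n ℤ.* + suc D'
    numerator′ (Fin.suc i) = c i ℤ.* + suc m

    cleared′ : ∀ (y : Fin (suc d) → ℕ) → toℚᵘ (sumℚ (λ i → α i *ℚ ℕ→ℚ (y i)))
                     ≃ mkℚᵘ (ℤΣ.sum (λ i → numerator′ i ℤ.* + y i)) denominator-1′
    cleared′ y = ℚᵘP.≃-trans (ℚP.toℚᵘ-homo-+ (α Fin.zero *ℚ ℕ→ℚ y₀) _)
      (ℚᵘP.≃-trans (ℚᵘP.+-cong (toℚᵘ-*-ℕ→ℚ (α Fin.zero) y₀) (tail≃ (y ∘ Fin.suc)))
                   (ℚᵘP.≃-reflexive (cong (λ k → mkℚᵘ k denominator-1′) numerator-identity)))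
      where
      open ≡-Reasoning
      y₀ = y Fin.zero
      S = ℤΣ.sum (λ i → c i ℤ.* + y (Fin.suc i))
      numerator-identity : (n ℤ.* + y₀) ℤ.* + suc D' ℤ.+ S ℤ.* + (suc m ℕ.* 1)
                         ≡ ℤΣ.sum (λ i → numerator′ i ℤ.* + y i)
      numerator-identity = begin
        (n ℤ.* + y₀) ℤ.* + suc D' ℤ.+ S ℤ.* + (suc m ℕ.* 1)
          ≡⟨ cong (λ k → (n ℤ.* + y₀) ℤ.* + suc D' ℤ.+ S ℤ.* + k) (ℕP.*-identityʳ (suc m)) ⟩
        (n ℤ.* + y₀) ℤ.* + suc D' ℤ.+ S ℤ.* + suc m
          ≡⟨ cong (ℤ._+ S ℤ.* + suc m) (swap n (+ y₀) (+ suc D')) ⟩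
        (n ℤ.* + suc D') ℤ.* + y₀ ℤ.+ S ℤ.* + suc m
          ≡⟨ cong (λ t → (n ℤ.* + suc D') ℤ.* + y₀ ℤ.+ t) (sum-*ʳ-assoc c (λ i → + y (Fin.suc i)) (+ suc m)) ⟨
        ℤΣ.sum (λ i → numerator′ i ℤ.* + y i) ∎
        where
        swap : ∀ a b c → (a ℤ.* b) ℤ.* c ≡ (a ℤ.* c) ℤ.* b
        swap = ℤ-solve-∀

  clear-denominators : ∀ {d} (α : Fin d → ℚ) → ClearedDenominators α
  clear-denominators {zero}  α = record { denominator-1 = 0 ; numerator = λ () ; cleared = λ _ → ℚᵘP.≃-refl }
  clear-denominators {suc d} α = cleared-cons α (clear-denominators (α ∘ Fin.suc))

  module IntegerRelation {d} {α : Fin d → ℚ} (cd : ClearedDenominators α) where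
    open ClearedDenominators cd

    D : ℕ
    D = suc denominator-1

    positive negative : Fin d → ℕ
    positive i = posPart (numerator i)
    negative i = negPart (numerator i)

    relation-in-ℕ : ∀ x (y : Fin d → ℕ) → ℕ→ℚ x +ℚ sumℚ (λ i → α i *ℚ ℕ→ℚ (y i)) ≡ 0ℚ →
                    x ℕ.* D ℕ.+ sum (λ i → positive i ℕ.* y i) ≡ sum (λ i → negative i ℕ.* y i)
    relation-in-ℕ x y eq = ℤP.+-injective (ℤP.i-j≡0⇒i≡j _ _ (begin
      + (x ℕ.* D ℕ.+ P) ℤ.- + N
        ≡⟨ cong (λ t → t ℤ.- + N) (trans (ℤP.pos-+ (x ℕ.* D) P) (cong (ℤ._+ + P) (ℤP.pos-* x D))) ⟩
      + x ℤ.* + D ℤ.+ + P ℤ.- + N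
        ≡⟨ regroup (+ x ℤ.* + D) (+ P) (+ N) ⟩
      + x ℤ.* + D ℤ.+ (+ P ℤ.- + N) ℤ.* + 1
        ≡⟨ cong (λ t → + x ℤ.* + D ℤ.+ t ℤ.* + 1) (sum-posPart-negPart numerator y) ⟨
      + x ℤ.* + D ℤ.+ ℤΣ.sum (λ i → numerator i ℤ.* + y i) ℤ.* + 1
        ≡⟨ ℚᵘP.p≃0⇒↥p≡0 _ fraction≃0 ⟩
      + 0 ∎))
      where
      open ≡-Reasoning
      P = sum (λ i → positive i ℕ.* y i)
      N = sum (λ i → negative i ℕ.* y i)
      fraction≃0 : mkℚᵘ (+ x) 0 ℚᵘ.+ mkℚᵘ (ℤΣ.sum (λ i → numerator i ℤ.* + y i)) denominator-1 ≃ ℚᵘ.0ℚᵘ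
      fraction≃0 = ℚᵘP.≃-trans
        (ℚᵘP.≃-sym (ℚᵘP.≃-trans (ℚP.toℚᵘ-homo-+ (ℕ→ℚ x) _) (ℚᵘP.+-cong (toℚᵘ-ℕ→ℚ x) (cleared y))))
        (ℚP.toℚᵘ-cong eq)
      regroup : ∀ a p n → a ℤ.+ p ℤ.- n ≡ a ℤ.+ (p ℤ.- n) ℤ.* + 1
      regroup = ℤ-solve-∀

open Denominators

Env : ℕ → Set
Env R = Fin R → ℕ

infixl 5 _[_]≔_
_[_]≔_ : ∀ {R} → Env R → Fin R → ℕ → Env R
σ [ x ]≔ a = updateAt σ x (const a)

update-same : ∀ {R} (σ : Env R) x a → (σ [ x ]≔ a) x ≡ a
update-same σ x a = VecFP.updateAt-updates x σ

update-other : ∀ {R} (σ : Env R) x a {z} → z ≢ x → (σ [ x ]≔ a) z ≡ σ z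
update-other σ x a {z} z≢x = VecFP.updateAt-minimal z x σ z≢x

module _ {R} (σ : Env R) {a b : Fin R} {u w : ℕ} where

  update₂-first : a ≢ b → (σ [ a ]≔ u [ b ]≔ w) a ≡ u
  update₂-first a≢b = trans (update-other _ b w a≢b) (update-same σ a u)

  update₂-second : (σ [ a ]≔ u [ b ]≔ w) b ≡ w
  update₂-second = update-same _ b w

  update₂-other : ∀ {z} → z ≢ a → z ≢ b → (σ [ a ]≔ u [ b ]≔ w) z ≡ σ z
  update₂-other z≢a z≢b = trans (update-other _ b w z≢b) (update-other σ a u z≢a)

update-id : ∀ {R} (σ : Env R) {x a} → σ x ≡ a → σ [ x ]≔ a ≗ σ
update-id σ {x} σx≡a = VecFP.updateAt-id-local x σ (sym σx≡a)

update-update : ∀ {R} (σ : Env R) x a b → σ [ x ]≔ a [ x ]≔ b ≗ σ [ x ]≔ b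
update-update σ x a b = VecFP.updateAt-updateAt x σ

≗-split₂ : ∀ {R} {σ τ : Env R} a b → σ a ≡ τ a → σ b ≡ τ b → (∀ {z} → z ≢ a → z ≢ b → σ z ≡ τ z) → σ ≗ τ
≗-split₂ a b eq-a eq-b eq-other z with z ≟ a | z ≟ b
... | yes refl | _        = eq-a
... | no _     | yes refl = eq-b
... | no z≢a   | no z≢b   = eq-other z≢a z≢b

increased : ∀ {R} → Env R → Fin R → Fin R → ℕ → ℕ → Env R
increased σ a b u w = σ [ a ]≔ σ a + u [ b ]≔ σ b + w

increased-increased : ∀ {R} (σ : Env R) {a b} → a ≢ b → ∀ u w u' w' →
  increased (increased σ a b u w) a b u' w' ≗ increased σ a b (u + u') (w + w')
increased-increased σ {a} {b} a≢b u w u' w' = ≗-split₂ a b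
  (trans (update₂-first (increased σ a b u w) a≢b) (trans (cong (_+ u') (update₂-first σ a≢b))
    (trans (ℕP.+-assoc (σ a) u u') (sym (update₂-first σ a≢b)))))
  (trans (update₂-second (increased σ a b u w)) (trans (cong (_+ w') (update₂-second σ))
    (trans (ℕP.+-assoc (σ b) w w') (sym (update₂-second σ)))))
  (λ z≢a z≢b → trans (update₂-other (increased σ a b u w) z≢a z≢b)
                 (trans (update₂-other σ z≢a z≢b) (sym (update₂-other σ z≢a z≢b))))

-- Configurations store the registers as a vector, the program logic views them as a function.
lookup-update : ∀ {R} (v : Vec ℕ R) {σ : Env R} x a → lookup v ≗ σ → lookup (v Vec.[ x ]≔ a) ≗ σ [ x ]≔ a
lookup-update v x a v≗σ z with z ≟ x
... | yes refl = trans (VecP.lookup∘update z v a) (sym (update-same _ z a))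
... | no z≢x   = trans (VecP.lookup∘update′ z≢x v a) (trans (v≗σ z) (sym (update-other _ x a z≢x)))

module ProgramLogic {R : ℕ} (prog : List (Instr R)) where

  P : Program R (length prog)
  P = Vec.fromList prog

  Reaches : Config R → ℕ → Config R → Set
  Reaches c b c' = Σ ℕ λ t → t ≤ b × run P t c ≡ c'

  run-+ : ∀ a b c → run P (a + b) c ≡ run P b (run P a c)
  run-+ zero    b c = refl
  run-+ (suc a) b c = run-+ a b (step P c)

  reaches-trans : ∀ {c₁ c₂ c₃ b₁ b₂} → Reaches c₁ b₁ c₂ → Reaches c₂ b₂ c₃ → Reaches c₁ (b₁ + b₂) c₃
  reaches-trans {c₁} (t₁ , t₁≤ , eq₁) (t₂ , t₂≤ , eq₂) =
    t₁ + t₂ , ℕP.+-mono-≤ t₁≤ t₂≤ , trans (run-+ t₁ t₂ c₁) (trans (cong (run P t₂) eq₁) eq₂)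

  record Triple (o ex : ℕ) (Pre Post : Env R → Set) (cost : ℕ) : Set where
    field
      runs : ∀ v → Pre (lookup v) → Σ (Vec ℕ R) λ v' → Reaches ⟨ o , v ⟩ cost ⟨ ex , v' ⟩ × Post (lookup v')
  open Triple public

  _⨾_ : ∀ {o₁ o₂ o₃ Pre Mid Post c₁ c₂} → Triple o₁ o₂ Pre Mid c₁ → Triple o₂ o₃ Mid Post c₂ →
        Triple o₁ o₃ Pre Post (c₁ + c₂)
  runs (h₁ ⨾ h₂) v pre with runs h₁ v pre
  ... | v₁ , r₁ , mid with runs h₂ v₁ mid
  ... | v₂ , r₂ , post = v₂ , reaches-trans r₁ r₂ , post
  infixr 4 _⨾_

  skip : ∀ {o Pre} → Triple o o Pre Pre 0
  runs skip v pre = v , (0 , z≤n , refl) , pre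

  weaken-post : ∀ {o ex Pre Post Post' c} → (∀ {ρ} → Post ρ → Post' ρ) → Triple o ex Pre Post c → Triple o ex Pre Post' c
  runs (weaken-post f h) v pre with runs h v pre
  ... | v' , r , post = v' , r , f post

  weaken-cost : ∀ {o ex Pre Post c c'} → c ≤ c' → Triple o ex Pre Post c → Triple o ex Pre Post c'
  runs (weaken-cost c≤c' h) v pre with runs h v pre
  ... | v' , (t , t≤c , eq) , post = v' , (t , ℕP.≤-trans t≤c c≤c' , eq) , post

  generalise : ∀ {o ex Pre Post c} → (∀ σ → Pre σ → Triple o ex (_≗ σ) Post c) → Triple o ex Pre Post c
  runs (generalise f) v pre = runs (f (lookup v) pre) v (λ _ → refl)

  Occurs : List (Instr R) → ℕ → Set
  Occurs b o = Σ (List (Instr R)) λ pre → Σ (List (Instr R)) λ post → (prog ≡ pre ++ b ++ post) × (length pre ≡ o)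

  occurs-whole : Occurs prog 0
  occurs-whole = [] , [] , sym (ListP.++-identityʳ prog) , refl

  occurs-tail : ∀ {i b o} → Occurs (i ∷ b) o → Occurs b (suc o)
  occurs-tail {i} {b} (pre , post , eq , refl) =
    pre ++ i ∷ [] , post , trans eq (sym (ListP.++-assoc pre (i ∷ []) (b ++ post))) ,
    trans (ListP.length-++ pre) (ℕP.+-comm (length pre) 1)

  occurs-++ˡ : ∀ {b₁ b₂ o} → Occurs (b₁ ++ b₂) o → Occurs b₁ o
  occurs-++ˡ {b₁} {b₂} (pre , post , eq , len) = pre , b₂ ++ post , trans eq (cong (pre ++_) (ListP.++-assoc b₁ b₂ post)) , len

  occurs-++ʳ : ∀ {b₁ b₂ o} → Occurs (b₁ ++ b₂) o → Occurs b₂ (o + length b₁)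
  occurs-++ʳ {b₁} {b₂} (pre , post , eq , refl) =
    pre ++ b₁ , post ,
    trans eq (trans (cong (pre ++_) (ListP.++-assoc b₁ b₂ post)) (sym (ListP.++-assoc pre b₁ (b₂ ++ post)))) ,
    ListP.length-++ pre

  occurs-++ʳ′ : ∀ {b₁ b₂ o ℓ} → length b₁ ≡ ℓ → Occurs (b₁ ++ b₂) o → Occurs b₂ (o + ℓ)
  occurs-++ʳ′ refl = occurs-++ʳ

  private
    fetch-at : ∀ pre (i : Instr R) post k (c : Config R) → fetch (Vec.fromList (pre ++ i ∷ post)) (length pre) k c ≡ k i
    fetch-at []        i post k c = refl
    fetch-at (_ ∷ pre) i post k c = fetch-at pre i post k c

  step-at : ∀ {i b o} → Occurs (i ∷ b) o → ∀ v → step P ⟨ o , v ⟩ ≡ execInstr i v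
  step-at {i} {b} (pre , post , eq , refl) v =
    subst (λ p → fetch (Vec.fromList p) (length pre) (λ j → execInstr j v) ⟨ length pre , v ⟩ ≡ execInstr i v)
          (sym eq) (fetch-at pre i (b ++ post) _ _)

  private
    exec-dec-zero : ∀ {x l₀ l₁} (v : Vec ℕ R) → lookup v x ≡ 0 → execInstr (dec x l₀ l₁) v ≡ ⟨ l₀ , v ⟩
    exec-dec-zero {x} v eq with lookup v x
    ... | zero = refl

    exec-dec-suc : ∀ {x l₀ l₁ m} (v : Vec ℕ R) → lookup v x ≡ suc m → execInstr (dec x l₀ l₁) v ≡ ⟨ l₁ , v Vec.[ x ]≔ m ⟩
    exec-dec-suc {x} v eq with lookup v x
    ... | suc _ = cong (λ m → ⟨ _ , v Vec.[ x ]≔ m ⟩) (ℕP.suc-injective eq)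

  inc-triple : ∀ {x l b o σ} → Occurs (inc x l ∷ b) o → Triple o l (_≗ σ) (_≗ σ [ x ]≔ suc (σ x)) 1
  runs (inc-triple {x} {σ = σ} occ) v v≗σ =
    v Vec.[ x ]≔ suc (lookup v x) , (1 , s≤s z≤n , step-at occ v) ,
    subst (λ a → lookup (v Vec.[ x ]≔ suc (lookup v x)) ≗ σ [ x ]≔ a) (cong suc (v≗σ x)) (lookup-update v x _ v≗σ)

  dec-zero-triple : ∀ {x l₀ l₁ b o σ} → Occurs (dec x l₀ l₁ ∷ b) o → σ x ≡ 0 → Triple o l₀ (_≗ σ) (_≗ σ) 1
  runs (dec-zero-triple {x} occ σx≡0) v v≗σ =
    v , (1 , s≤s z≤n , trans (step-at occ v) (exec-dec-zero v (trans (v≗σ x) σx≡0))) , v≗σ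

  dec-suc-triple : ∀ {x l₀ l₁ b o σ m} → Occurs (dec x l₀ l₁ ∷ b) o → σ x ≡ suc m → Triple o l₁ (_≗ σ) (_≗ σ [ x ]≔ m) 1
  runs (dec-suc-triple {x} {m = m} occ σx≡1+m) v v≗σ =
    v Vec.[ x ]≔ m , (1 , s≤s z≤n , trans (step-at occ v) (exec-dec-suc v (trans (v≗σ x) σx≡1+m))) ,
    lookup-update v x m v≗σ

copyLength : ℕ → ℕ → ℕ
copyLength p q = suc (suc (p + q)) + 2

copiesLength : ∀ {n} (p q : Fin n → ℕ) → ℕ
copiesLength p q = sum (λ i → copyLength (p i) (q i))

module _ {R : ℕ} where

  multiplicity : Fin R → List (Fin R) → ℕ
  multiplicity z []       = 0
  multiplicity z (y ∷ ys) with z ≟ y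
  ... | yes _ = suc (multiplicity z ys)
  ... | no  _ = multiplicity z ys

  multiplicity-here : ∀ z ys → multiplicity z (z ∷ ys) ≡ suc (multiplicity z ys)
  multiplicity-here z ys with z ≟ z
  ... | yes _   = refl
  ... | no  z≢z = ⊥-elim (z≢z refl)

  multiplicity-there : ∀ {z y} ys → z ≢ y → multiplicity z (y ∷ ys) ≡ multiplicity z ys
  multiplicity-there {z} {y} ys z≢y with z ≟ y
  ... | yes z≡y = ⊥-elim (z≢y z≡y)
  ... | no  _   = refl

  multiplicity-++ : ∀ z ys ys' → multiplicity z (ys ++ ys') ≡ multiplicity z ys + multiplicity z ys'
  multiplicity-++ z []       ys' = refl
  multiplicity-++ z (y ∷ ys) ys' with z ≟ y
  ... | yes _ = cong suc (multiplicity-++ z ys ys')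
  ... | no  _ = multiplicity-++ z ys ys'

  multiplicity-replicate : ∀ z k → multiplicity z (replicate k z) ≡ k
  multiplicity-replicate z zero    = refl
  multiplicity-replicate z (suc k) = trans (multiplicity-here z _) (cong suc (multiplicity-replicate z k))

  multiplicity-replicate-other : ∀ {z y} k → z ≢ y → multiplicity z (replicate k y) ≡ 0
  multiplicity-replicate-other zero    z≢y = refl
  multiplicity-replicate-other (suc k) z≢y = trans (multiplicity-there _ z≢y) (multiplicity-replicate-other k z≢y)

  replicates : ∀ {n} → (Fin n → Fin R) → (Fin n → ℕ) → List (Fin R)
  replicates {zero}  X f = []
  replicates {suc n} X f = replicate (f Fin.zero) (X Fin.zero) ++ replicates (X ∘ Fin.suc) (f ∘ Fin.suc)

  multiplicity-replicates-other : ∀ {n} (X : Fin n → Fin R) f {z} → (∀ i → z ≢ X i) → multiplicity z (replicates X f) ≡ 0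
  multiplicity-replicates-other {zero}  X f z∉X = refl
  multiplicity-replicates-other {suc n} X f {z} z∉X = trans (multiplicity-++ z (replicate (f Fin.zero) (X Fin.zero)) _)
    (cong₂ _+_ (multiplicity-replicate-other (f Fin.zero) (z∉X Fin.zero)) (multiplicity-replicates-other (X ∘ Fin.suc) (f ∘ Fin.suc) (z∉X ∘ Fin.suc)))

  multiplicity-replicates : ∀ {n} (X : Fin n → Fin R) f → Injective _≡_ _≡_ X → ∀ i → multiplicity (X i) (replicates X f) ≡ f i
  multiplicity-replicates X f X-injective Fin.zero = trans (multiplicity-++ (X Fin.zero) (replicate (f Fin.zero) (X Fin.zero)) _)
    (trans (cong₂ _+_ (multiplicity-replicate (X Fin.zero) (f Fin.zero))
                      (multiplicity-replicates-other (X ∘ Fin.suc) (f ∘ Fin.suc) (λ i eq → FinP.0≢1+n (X-injective eq))))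
           (ℕP.+-identityʳ (f Fin.zero)))
  multiplicity-replicates X f X-injective (Fin.suc i) = trans (multiplicity-++ (X (Fin.suc i)) (replicate (f Fin.zero) (X Fin.zero)) _)
    (cong₂ _+_ (multiplicity-replicate-other (f Fin.zero) (λ eq → FinP.0≢1+n (sym (X-injective eq))))
               (multiplicity-replicates (X ∘ Fin.suc) (f ∘ Fin.suc) (FinP.suc-injective ∘ X-injective) i))

  incChain : List (Fin R) → ℕ → ℕ → List (Instr R)
  incChain []            o target = []
  incChain (y ∷ [])      o target = inc y target ∷ []
  incChain (y ∷ y' ∷ ys) o target = inc y (suc o) ∷ incChain (y' ∷ ys) (suc o) target

  chainEntry : List (Fin R) → ℕ → ℕ → ℕ
  chainEntry []      o target = target
  chainEntry (_ ∷ _) o target = o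

  length-incChain : ∀ ys o target → length (incChain ys o target) ≡ length ys
  length-incChain []            o target = refl
  length-incChain (y ∷ [])      o target = refl
  length-incChain (y ∷ y' ∷ ys) o target = cong suc (length-incChain (y' ∷ ys) (suc o) target)

  -- while x ≠ 0 do (x := x - 1; increment ys); then jump to ex
  transferCode : Fin R → List (Fin R) → ℕ → ℕ → List (Instr R)
  transferCode x ys o ex = dec x ex (chainEntry ys (suc o) o) ∷ incChain ys (suc o) o

  length-transferCode : ∀ x ys o ex → length (transferCode x ys o ex) ≡ suc (length ys)
  length-transferCode x ys o ex = cong suc (length-incChain ys (suc o) o)

  transferred : Fin R → List (Fin R) → Env R → Env R
  transferred x ys σ = (λ z → σ z + multiplicity z ys * σ x) [ x ]≔ 0

  transferred-source : ∀ x ys (σ : Env R) → transferred x ys σ x ≡ 0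
  transferred-source x ys σ = update-same _ x 0

  transferred-other : ∀ x ys (σ : Env R) {z} → z ≢ x → transferred x ys σ z ≡ σ z + multiplicity z ys * σ x
  transferred-other x ys σ z≢x = update-other _ x 0 z≢x

  moved-other : ∀ {x y z} (σ : Env R) → z ≢ x → z ≢ y → transferred x (y ∷ []) σ z ≡ σ z
  moved-other {x} {y} {z} σ z≢x z≢y = trans (transferred-other x (y ∷ []) σ z≢x)
    (trans (cong (λ m → σ z + m * σ x) (multiplicity-there [] z≢y)) (ℕP.+-identityʳ (σ z)))

  moved-into-empty : ∀ {x y} (σ : Env R) → y ≢ x → σ y ≡ 0 → transferred x (y ∷ []) σ y ≡ σ x
  moved-into-empty {x} {y} σ y≢x σy≡0 = trans (transferred-other x (y ∷ []) σ y≢x)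
    (trans (cong₂ (λ u m → u + m * σ x) σy≡0 (multiplicity-here y [])) (ℕP.+-identityʳ (σ x)))

  increment-multiplicity : ∀ (σ : Env R) y ys z →
    (σ [ y ]≔ suc (σ y)) z + multiplicity z ys ≡ σ z + multiplicity z (y ∷ ys)
  increment-multiplicity σ y ys z with z ≟ y
  ... | yes refl = trans (cong (_+ multiplicity z ys) (update-same σ z _)) (sym (ℕP.+-suc (σ z) _))
  ... | no  z≢y  = cong (_+ multiplicity z ys) (update-other σ y _ z≢y)

  transferred-step : ∀ (σ : Env R) {x ys m} → σ x ≡ suc m → multiplicity x ys ≡ 0 →
    transferred x ys (λ z → (σ [ x ]≔ m) z + multiplicity z ys) ≗ transferred x ys σ
  transferred-step σ {x} {ys} {m} σx≡1+m x∉ys z with z ≟ x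
  ... | yes refl = trans (update-same _ z 0) (sym (update-same _ z 0))
  ... | no  z≢x  = begin
    _                                                  ≡⟨ update-other _ x 0 z≢x ⟩
    (σ [ x ]≔ m) z + c + c * ((σ [ x ]≔ m) x + multiplicity x ys)
                                                       ≡⟨ cong₂ (λ u v → u + c + c * v) (update-other σ x m z≢x)
                                                                (trans (cong₂ _+_ (update-same σ x m) x∉ys) (ℕP.+-identityʳ m)) ⟩
    σ z + c + c * m                                    ≡⟨ ℕP.+-assoc (σ z) c (c * m) ⟩
    σ z + (c + c * m)                                  ≡⟨ cong (λ v → σ z + v) (trans (cong (c *_) σx≡1+m) (ℕP.*-suc c m)) ⟨
    σ z + c * σ x                                      ≡⟨ update-other _ x 0 z≢x ⟨
    transferred x ys σ z                               ∎
    where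
    open ≡-Reasoning
    c = multiplicity z ys

  subtractCode : Fin R → Fin R → ℕ → ℕ → List (Instr R)
  subtractCode a b o ex = dec b ex (suc o) ∷ dec a o o ∷ []

  -- decrement a up to k times, leaving for ex as soon as a is 0
  decChain : Fin R → ℕ → ℕ → ℕ → List (Instr R)
  decChain a zero    o ex = []
  decChain a (suc k) o ex = dec a ex (suc o) ∷ decChain a k (suc o) ex

  length-decChain : ∀ a k o ex → length (decChain a k o ex) ≡ k
  length-decChain a zero    o ex = refl
  length-decChain a (suc k) o ex = cong suc (length-decChain a k (suc o) ex)

  divideCode : Fin R → Fin R → (D : ℕ) → ℕ → ℕ → List (Instr R)
  divideCode a y D o ex = decChain a D o ex ++ inc y o ∷ []

  length-divideCode : ∀ (a y : Fin R) D o ex → length (divideCode a y D o ex) ≡ D + 1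
  length-divideCode a y D o ex = trans (ListP.length-++ (decChain a D o ex)) (cong (_+ 1) (length-decChain a D o ex))

  divided : Fin R → Fin R → (D : ℕ) .{{_ : ℕ.NonZero D}} → Env R → Env R
  divided a y D σ = σ [ a ]≔ 0 [ y ]≔ σ y + σ a / D

  divided-small : ∀ {a y} D .{{_ : ℕ.NonZero D}} (σ : Env R) → a ≢ y → σ a < D → σ [ a ]≔ 0 ≗ divided a y D σ
  divided-small {a} {y} D σ a≢y σa<D = ≗-split₂ a y
    (trans (update-same σ a 0) (sym (update₂-first σ a≢y)))
    (trans (update-other σ a 0 (≢-sym a≢y))
           (sym (trans (update₂-second σ) (trans (cong (σ y +_) (DM.m<n⇒m/n≡0 σa<D)) (ℕP.+-identityʳ (σ y))))))
    (λ z≢a z≢y → trans (update-other σ a 0 z≢a) (sym (update₂-other σ z≢a z≢y)))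

  divided-step : ∀ {a y} D .{{_ : ℕ.NonZero D}} (σ : Env R) → a ≢ y → D ≤ σ a →
    divided a y D (σ [ a ]≔ σ a ∸ D [ y ]≔ suc ((σ [ a ]≔ σ a ∸ D) y)) ≗ divided a y D σ
  divided-step {a} {y} D σ a≢y D≤σa = ≗-split₂ a y
    (trans (update₂-first σ₂ a≢y) (sym (update₂-first σ a≢y)))
    (begin
      divided a y D σ₂ y              ≡⟨ update₂-second σ₂ ⟩
      σ₂ y + σ₂ a / D                 ≡⟨ cong₂ (λ u v → u + v / D) σ₂y (update₂-first σ a≢y) ⟩
      suc (σ y) + (σ a ∸ D) / D       ≡⟨ ℕP.+-suc (σ y) _ ⟨
      σ y + suc ((σ a ∸ D) / D)       ≡⟨ cong (σ y +_) (DM.m/n≡1+[m∸n]/n D≤σa) ⟨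
      σ y + σ a / D                   ≡⟨ update₂-second σ ⟨
      divided a y D σ y               ∎)
    (λ z≢a z≢y → trans (update₂-other σ₂ z≢a z≢y) (trans (update₂-other σ z≢a z≢y) (sym (update₂-other σ z≢a z≢y))))
    where
    open ≡-Reasoning
    σ₂ = σ [ a ]≔ σ a ∸ D [ y ]≔ suc ((σ [ a ]≔ σ a ∸ D) y)
    σ₂y : σ₂ y ≡ suc (σ y)
    σ₂y = trans (update₂-second σ) (cong suc (update-other σ a _ (≢-sym a≢y)))

  copyCode : (x a b t : Fin R) (p q o ex : ℕ) → List (Instr R)
  copyCode x a b t p q o ex =
    transferCode x (t ∷ replicate p a ++ replicate q b) o (o + suc (suc (p + q))) ++
    transferCode t (x ∷ []) (o + suc (suc (p + q))) ex

  length-copyCode : ∀ x a b t p q o ex → length (copyCode x a b t p q o ex) ≡ suc (suc (p + q)) + 2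
  length-copyCode x a b t p q o ex = trans (ListP.length-++ (transferCode x ys o o₁))
    (cong (_+ 2) (trans (length-transferCode x ys o o₁)
                        (cong (suc ∘ suc) (trans (ListP.length-++ (replicate p a)) (cong₂ _+_ (ListP.length-replicate p) (ListP.length-replicate q))))))
    where
    ys = t ∷ replicate p a ++ replicate q b
    o₁ = o + suc (suc (p + q))

  transferred-scratch : ∀ {x t} (σ : Env R) rs → t ≢ x → multiplicity t rs ≡ 0 → σ t ≡ 0 →
    transferred x (t ∷ rs) σ t ≡ σ x
  transferred-scratch {x} {t} σ rs t≢x t∉rs σt≡0 =
    trans (transferred-other x (t ∷ rs) σ t≢x)
      (trans (cong₂ (λ u m → u + m * σ x) σt≡0 (trans (multiplicity-here t rs) (cong suc t∉rs))) (ℕP.+-identityʳ (σ x)))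

  transferred-back : ∀ {x t} (σ : Env R) rs → t ≢ x → multiplicity t rs ≡ 0 → multiplicity x rs ≡ 0 → σ t ≡ 0 →
    transferred t (x ∷ []) (transferred x (t ∷ rs) σ) ≗ λ z → σ z + multiplicity z rs * σ x
  transferred-back {x} {t} σ rs t≢x t∉rs x∉rs σt≡0 z with z ≟ t | z ≟ x
  ... | yes refl | _        = trans (transferred-source t (x ∷ []) σ₁)
                                (sym (trans (cong₂ (λ u m → u + m * σ x) σt≡0 t∉rs) (ℕP.*-zeroʳ 0)))
    where σ₁ = transferred x (t ∷ rs) σ
  ... | no z≢t   | yes refl = begin
    transferred t (z ∷ []) σ₁ z                  ≡⟨ transferred-other t (z ∷ []) σ₁ z≢t ⟩
    σ₁ z + multiplicity z (z ∷ []) * σ₁ t        ≡⟨ cong₂ (λ u m → u + m * σ₁ t) (transferred-source z (t ∷ rs) σ) (multiplicity-here z []) ⟩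
    σ₁ t + 0                                     ≡⟨ ℕP.+-identityʳ (σ₁ t) ⟩
    σ₁ t                                         ≡⟨ transferred-scratch σ rs t≢x t∉rs σt≡0 ⟩
    σ z                                          ≡⟨ ℕP.+-identityʳ (σ z) ⟨
    σ z + 0                                      ≡⟨ cong (λ m → σ z + m * σ z) x∉rs ⟨
    σ z + multiplicity z rs * σ z                ∎
    where
    open ≡-Reasoning
    σ₁ = transferred x (t ∷ rs) σ
  ... | no z≢t   | no z≢x   = begin
    transferred t (x ∷ []) σ₁ z                  ≡⟨ transferred-other t (x ∷ []) σ₁ z≢t ⟩
    σ₁ z + multiplicity z (x ∷ []) * σ₁ t        ≡⟨ cong (λ m → σ₁ z + m * σ₁ t) (multiplicity-there [] z≢x) ⟩
    σ₁ z + 0                                     ≡⟨ ℕP.+-identityʳ (σ₁ z) ⟩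
    σ₁ z                                         ≡⟨ transferred-other x (t ∷ rs) σ z≢x ⟩
    σ z + multiplicity z (t ∷ rs) * σ x          ≡⟨ cong (λ m → σ z + m * σ x) (multiplicity-there rs z≢t) ⟩
    σ z + multiplicity z rs * σ x                ∎
    where
    open ≡-Reasoning
    σ₁ = transferred x (t ∷ rs) σ

  multiplicity-replicate₂-other : ∀ {z a b} p q → z ≢ a → z ≢ b → multiplicity z (replicate p a ++ replicate q b) ≡ 0
  multiplicity-replicate₂-other {z} {a} p q z≢a z≢b = trans (multiplicity-++ z (replicate p a) _)
    (cong₂ _+_ (multiplicity-replicate-other p z≢a) (multiplicity-replicate-other q z≢b))

  multiplicity-replicate₂ : ∀ (σ : Env R) {a b} → a ≢ b → ∀ p q v →
    (λ z → σ z + multiplicity z (replicate p a ++ replicate q b) * v) ≗ increased σ a b (p * v) (q * v)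
  multiplicity-replicate₂ σ {a} {b} a≢b p q v = ≗-split₂ a b
    (trans (cong (λ m → σ a + m * v) (trans (multiplicity-++ a (replicate p a) _)
             (trans (cong₂ _+_ (multiplicity-replicate a p) (multiplicity-replicate-other q a≢b)) (ℕP.+-identityʳ p))))
           (sym (update₂-first σ a≢b)))
    (trans (cong (λ m → σ b + m * v) (trans (multiplicity-++ b (replicate p a) _)
             (cong₂ _+_ (multiplicity-replicate-other p (≢-sym a≢b)) (multiplicity-replicate b q))))
           (sym (update₂-second σ)))
    (λ {z} z≢a z≢b → trans (cong (λ m → σ z + m * v) (multiplicity-replicate₂-other p q z≢a z≢b))
                           (trans (ℕP.+-identityʳ (σ z)) (sym (update₂-other σ z≢a z≢b))))

  copiesCode : ∀ {n} (reg : Fin n → Fin R) (p q : Fin n → ℕ) (a b t : Fin R) (o : ℕ) → List (Instr R)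
  copiesCode {zero}  reg p q a b t o = []
  copiesCode {suc n} reg p q a b t o =
    copyCode (reg Fin.zero) a b t (p Fin.zero) (q Fin.zero) o o' ++
    copiesCode (reg ∘ Fin.suc) (p ∘ Fin.suc) (q ∘ Fin.suc) a b t o'
    where o' = o + copyLength (p Fin.zero) (q Fin.zero)

  length-copiesCode : ∀ {n} reg (p q : Fin n → ℕ) a b t o → length (copiesCode reg p q a b t o) ≡ copiesLength p q
  length-copiesCode {zero}  reg p q a b t o = refl
  length-copiesCode {suc n} reg p q a b t o =
    trans (ListP.length-++ (copyCode (reg Fin.zero) a b t (p Fin.zero) (q Fin.zero) o _))
          (cong₂ _+_ (length-copyCode (reg Fin.zero) a b t (p Fin.zero) (q Fin.zero) o _) (length-copiesCode (reg ∘ Fin.suc) (p ∘ Fin.suc) (q ∘ Fin.suc) a b t _))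

  -- X₀ := X₁, …, X_{e-1} := X_e, X_e := y, y := 0, assuming X₀ = 0
  shiftCode : ∀ e (X : Fin (suc e) → Fin R) (y : Fin R) (o ex : ℕ) → List (Instr R)
  shiftCode zero    X y o ex = transferCode y (X Fin.zero ∷ []) o ex
  shiftCode (suc e) X y o ex =
    transferCode (X (Fin.suc Fin.zero)) (X Fin.zero ∷ []) o (o + 2) ++ shiftCode e (X ∘ Fin.suc) y (o + 2) ex

  record Shifted {e} (X : Fin (suc e) → Fin R) (y : Fin R) (σ ρ : Env R) : Set where
    field
      moved   : ∀ j → ρ (X (Fin.inject₁ j)) ≡ σ (X (Fin.suc j))
      last    : ρ (X (Fin.fromℕ e)) ≡ σ y
      emptied : ρ y ≡ 0
      frame   : ∀ {z} → (∀ i → z ≢ X i) → z ≢ y → ρ z ≡ σ z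

  shifted-cons : ∀ {e} (X : Fin (suc (suc e)) → Fin R) {y} {σ ρ : Env R} → Injective _≡_ _≡_ X → (∀ i → X i ≢ y) →
    σ (X Fin.zero) ≡ 0 → Shifted (X ∘ Fin.suc) y (transferred (X (Fin.suc Fin.zero)) (X Fin.zero ∷ []) σ) ρ → Shifted X y σ ρ
  shifted-cons X {y} {σ} {ρ} X-injective X≢y σX₀≡0 sh = record
    { moved   = moved′
    ; last    = trans last (moved-other σ (X≢y _ ∘ sym) (X≢y _ ∘ sym))
    ; emptied = emptied
    ; frame   = λ z∉X z≢y → trans (frame (z∉X ∘ Fin.suc) z≢y) (moved-other σ (z∉X _) (z∉X _))
    }
    where
    open Shifted sh
    moved′ : ∀ j → ρ (X (Fin.inject₁ j)) ≡ σ (X (Fin.suc j))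
    moved′ Fin.zero    = trans (frame (λ i → (λ ()) ∘ X-injective) (X≢y Fin.zero))
                               (moved-into-empty σ ((λ ()) ∘ X-injective) σX₀≡0)
    moved′ (Fin.suc j) = trans (moved j) (moved-other σ ((λ ()) ∘ X-injective) ((λ ()) ∘ X-injective))

module Blocks {R : ℕ} (prog : List (Instr R)) where
  open ProgramLogic prog

  incChain-triple : ∀ ys {o target σ} → Occurs (incChain ys o target) o →
    Triple (chainEntry ys o target) target (_≗ σ) (_≗ λ z → σ z + multiplicity z ys) (length ys)
  incChain-triple []            occ = weaken-post (λ ρ≗σ z → trans (ρ≗σ z) (sym (ℕP.+-identityʳ _))) skip
  incChain-triple (y ∷ [])      {σ = σ} occ =
    weaken-post (λ ρ≗ z → trans (ρ≗ z) (trans (sym (ℕP.+-identityʳ _)) (increment-multiplicity σ y [] z)))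
                (inc-triple occ)
  incChain-triple (y ∷ y' ∷ ys) {σ = σ} occ =
    weaken-post (λ ρ≗ z → trans (ρ≗ z) (increment-multiplicity σ y (y' ∷ ys) z))
                (inc-triple occ ⨾ incChain-triple (y' ∷ ys) (occurs-tail occ))

  transfer-triple : ∀ x ys {o ex} → Occurs (transferCode x ys o ex) o → multiplicity x ys ≡ 0 → ∀ σ →
    Triple o ex (_≗ σ) (_≗ transferred x ys σ) (σ x * suc (length ys) + 1)
  transfer-triple x ys {o} {ex} occ x∉ys σ = go (σ x) σ refl
    where
    k = length ys
    go : ∀ m σ → σ x ≡ m → Triple o ex (_≗ σ) (_≗ transferred x ys σ) (m * suc k + 1)
    go zero    σ σx≡0   = weaken-post (λ ρ≗σ z → trans (ρ≗σ z) (drained z)) (dec-zero-triple occ σx≡0)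
      where
      drained : σ ≗ transferred x ys σ
      drained z with z ≟ x
      ... | yes refl = trans σx≡0 (sym (update-same _ z 0))
      ... | no  z≢x  = sym (trans (update-other _ x 0 z≢x)
                             (trans (cong (λ v → σ z + multiplicity z ys * v) σx≡0)
                               (trans (cong (σ z +_) (ℕP.*-zeroʳ (multiplicity z ys))) (ℕP.+-identityʳ (σ z)))))
    go (suc m) σ σx≡1+m =
      weaken-cost (ℕP.≤-reflexive (cong suc (sym (ℕP.+-assoc k (m * suc k) 1))))
        (dec-suc-triple occ σx≡1+m ⨾ incChain-triple ys (occurs-tail occ) ⨾
         weaken-post (λ ρ≗ z → trans (ρ≗ z) (transferred-step σ {x} {ys} σx≡1+m x∉ys z)) (go m _ σ'x≡m))
      where
      σ'x≡m : (σ [ x ]≔ m) x + multiplicity x ys ≡ m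
      σ'x≡m = trans (cong₂ _+_ (update-same σ x m) x∉ys) (ℕP.+-identityʳ m)

  subtract-triple : ∀ a b {o ex} → a ≢ b → Occurs (subtractCode a b o ex) o → ∀ σ →
    Triple o ex (_≗ σ) (_≗ σ [ a ]≔ σ a ∸ σ b [ b ]≔ 0) (σ b * 2 + 1)
  subtract-triple a b {o} {ex} a≢b occ σ = go (σ b) σ refl
    where
    b≢a : b ≢ a
    b≢a = ≢-sym a≢b
    go : ∀ m σ → σ b ≡ m → Triple o ex (_≗ σ) (_≗ σ [ a ]≔ σ a ∸ m [ b ]≔ 0) (m * 2 + 1)
    go zero σ σb≡0 = weaken-post (λ ρ≗ z → trans (ρ≗ z) (done z)) (dec-zero-triple occ σb≡0)
      where
      done : σ ≗ σ [ a ]≔ σ a [ b ]≔ 0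
      done = ≗-split₂ a b (sym (update₂-first σ a≢b)) (trans σb≡0 (sym (update₂-second σ)))
                          (λ z≢a z≢b → sym (update₂-other σ z≢a z≢b))
    go (suc m) σ σb≡1+m with σ a in σa
    ... | zero  = dec-suc-triple occ σb≡1+m ⨾ dec-zero-triple (occurs-tail occ) σ₁a≡0 ⨾
                  weaken-post (λ ρ≗ z → trans (ρ≗ z) (done z)) (go m σ₁ (update-same σ b m))
      where
      σ₁ = σ [ b ]≔ m
      σ₁a≡0 : σ₁ a ≡ 0
      σ₁a≡0 = trans (update-other σ b m a≢b) σa
      done : σ₁ [ a ]≔ σ₁ a ∸ m [ b ]≔ 0 ≗ σ [ a ]≔ 0 [ b ]≔ 0
      done = ≗-split₂ a b (trans (update₂-first σ₁ a≢b) (trans (cong (_∸ m) σ₁a≡0) (trans (ℕP.0∸n≡0 m) (sym (update₂-first σ a≢b)))))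
                          (trans (update₂-second σ₁) (sym (update₂-second σ)))
                          (λ z≢a z≢b → trans (update₂-other σ₁ z≢a z≢b) (trans (update-other σ b m z≢b) (sym (update₂-other σ z≢a z≢b))))
    ... | suc j = dec-suc-triple occ σb≡1+m ⨾ dec-suc-triple (occurs-tail occ) σ₁a≡1+j ⨾
                  weaken-post (λ ρ≗ z → trans (ρ≗ z) (done z)) (go m σ₂ σ₂b≡m)
      where
      σ₁ = σ [ b ]≔ m
      σ₂ = σ₁ [ a ]≔ j
      σ₁a≡1+j : σ₁ a ≡ suc j
      σ₁a≡1+j = trans (update-other σ b m a≢b) σa
      σ₂b≡m : σ₂ b ≡ m
      σ₂b≡m = update₂-first σ b≢a
      done : σ₂ [ a ]≔ σ₂ a ∸ m [ b ]≔ 0 ≗ σ [ a ]≔ j ∸ m [ b ]≔ 0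
      done = ≗-split₂ a b (trans (update₂-first σ₂ a≢b) (trans (cong (_∸ m) (update-same σ₁ a j)) (sym (update₂-first σ a≢b))))
                          (trans (update₂-second σ₂) (sym (update₂-second σ)))
                          (λ z≢a z≢b → trans (update₂-other σ₂ z≢a z≢b) (trans (update₂-other σ z≢b z≢a) (sym (update₂-other σ z≢a z≢b))))

  exit-at : ∀ {o ex ex' Pre Post c} → ex ≡ ex' → Triple o ex Pre Post c → Triple o ex' Pre Post c
  exit-at refl h = h

  decChain-≤ : ∀ a k {o ex} σ → Occurs (decChain a k o ex) o → k ≤ σ a →
    Triple o (o + k) (_≗ σ) (_≗ σ [ a ]≔ σ a ∸ k) k
  decChain-≤ a zero    {o} σ occ _ =
    exit-at (sym (ℕP.+-identityʳ o)) (weaken-post (λ ρ≗ z → trans (ρ≗ z) (sym (update-id σ refl z))) skip)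
  decChain-≤ a (suc k) {o} σ occ k<σa with σ a in σa
  ... | suc n = exit-at (sym (ℕP.+-suc o k))
                  (dec-suc-triple occ σa ⨾
                   weaken-post (λ ρ≗ z → trans (ρ≗ z) (trans (cong (λ v → (σ [ a ]≔ n [ a ]≔ v ∸ k) z) (update-same σ a n))
                                                              (update-update σ a n (n ∸ k) z)))
                               (decChain-≤ a k (σ [ a ]≔ n) (occurs-tail occ) (subst (k ≤_) (sym (update-same σ a n)) (ℕP.≤-pred k<σa))))

  decChain-> : ∀ a k {o ex} σ → Occurs (decChain a k o ex) o → σ a < k →
    Triple o ex (_≗ σ) (_≗ σ [ a ]≔ 0) (suc (σ a))
  decChain-> a (suc k) σ occ σa<k with σ a in σa
  ... | zero  = weaken-post (λ ρ≗ z → trans (ρ≗ z) (sym (update-id σ σa z))) (dec-zero-triple occ σa)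
  ... | suc n = dec-suc-triple occ σa ⨾
                weaken-post (λ ρ≗ z → trans (ρ≗ z) (update-update σ a n 0 z))
                  (weaken-cost (ℕP.≤-reflexive (cong suc (update-same σ a n)))
                    (decChain-> a k (σ [ a ]≔ n) (occurs-tail occ) (subst (_< k) (sym (update-same σ a n)) (ℕP.≤-pred σa<k))))

  divide-cost : ∀ D' r → suc D' + (1 + suc (suc D') * suc r) ≤ suc (suc D') * suc (suc D' + r)
  divide-cost D' r = subst (suc D' + (1 + suc (suc D') * suc r) ≤_) (identity D' r) (ℕP.m≤m+n _ (suc (suc D') * D'))
    where
    identity : ∀ D' r → suc D' + (1 + suc (suc D') * suc r) + suc (suc D') * D' ≡ suc (suc D') * suc (suc D' + r)
    identity = solve-∀

  divide-triple : ∀ a y D' {o ex} → a ≢ y → Occurs (divideCode a y (suc D') o ex) o → ∀ σ →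
    Triple o ex (_≗ σ) (_≗ divided a y (suc D') σ) (suc (suc D') * suc (σ a))
  divide-triple a y D' {o} {ex} a≢y occ σ = <-rec Divides divides (σ a) σ refl
    where
    D = suc D'
    Divides : ℕ → Set
    Divides n = ∀ σ → σ a ≡ n → Triple o ex (_≗ σ) (_≗ divided a y D σ) (suc D * suc n)
    chain-occ = occurs-++ˡ occ
    inc-occ = occurs-++ʳ′ (length-decChain a D o ex) occ

    divides : ∀ n → (∀ {m} → m < n → Divides m) → Divides n
    divides n rec σ refl with D ℕP.≤? σ a
    ... | no σa≱D = weaken-cost (ℕP.m≤n*m (suc (σ a)) (suc D))
                      (weaken-post (λ ρ≗ z → trans (ρ≗ z) (divided-small D σ a≢y σa<D z))
                        (decChain-> a D σ chain-occ σa<D))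
      where σa<D = ℕP.≰⇒> σa≱D
    ... | yes D≤σa = weaken-cost cost≤
                       (decChain-≤ a D σ chain-occ D≤σa ⨾ inc-triple inc-occ ⨾
                        weaken-post (λ ρ≗ z → trans (ρ≗ z) (divided-step D σ a≢y D≤σa z))
                          (rec (ℕP.∸-monoʳ-< {o = 0} (s≤s z≤n) D≤σa) _ (update₂-first σ a≢y)))
      where
      cost≤ : D + (1 + suc D * suc (σ a ∸ D)) ≤ suc D * suc (σ a)
      cost≤ = subst (λ n → D + (1 + suc D * suc (σ a ∸ D)) ≤ suc D * suc n) (ℕP.m+[n∸m]≡n D≤σa) (divide-cost D' (σ a ∸ D))

  copy-triple : ∀ x a b t p q {o ex} → x ≢ a → x ≢ b → x ≢ t → a ≢ b → a ≢ t → b ≢ t →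
    Occurs (copyCode x a b t p q o ex) o → ∀ σ → σ t ≡ 0 →
    Triple o ex (_≗ σ) (_≗ increased σ a b (p * σ x) (q * σ x)) (σ x * (4 + (p + q)) + 2)
  copy-triple x a b t p q {o} {ex} x≢a x≢b x≢t a≢b a≢t b≢t occ σ σt≡0 =
    weaken-cost (ℕP.≤-reflexive cost≡)
      (weaken-post (λ ρ≗ z → trans (ρ≗ z) (trans (transferred-back σ rs t≢x t∉rs x∉rs σt≡0 z) (multiplicity-replicate₂ σ a≢b p q (σ x) z)))
        (transfer-triple x (t ∷ rs) (occurs-++ˡ occ) (trans (multiplicity-there rs x≢t) x∉rs) σ ⨾
         transfer-triple t (x ∷ []) occ₂ (multiplicity-there [] t≢x) _))
    where
    rs = replicate p a ++ replicate q b
    o₁ = o + suc (suc (p + q))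
    t≢x = ≢-sym x≢t
    x∉rs = multiplicity-replicate₂-other p q x≢a x≢b
    t∉rs = multiplicity-replicate₂-other p q (≢-sym a≢t) (≢-sym b≢t)
    length-rs : length rs ≡ p + q
    length-rs = trans (ListP.length-++ (replicate p a)) (cong₂ _+_ (ListP.length-replicate p) (ListP.length-replicate q))
    occ₂ : Occurs (transferCode t (x ∷ []) o₁ ex) o₁
    occ₂ = occurs-++ʳ′ (trans (length-transferCode x (t ∷ rs) o o₁) (cong (suc ∘ suc) length-rs)) occ
    cost≡ : σ x * suc (length (t ∷ rs)) + 1 + (transferred x (t ∷ rs) σ t * 2 + 1) ≡ σ x * (4 + (p + q)) + 2
    cost≡ = trans (cong₂ (λ ℓ v → σ x * suc (suc ℓ) + 1 + (v * 2 + 1)) length-rs (transferred-scratch σ rs t≢x t∉rs σt≡0))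
                  (identity (σ x) (p + q))
      where
      identity : ∀ v n → v * suc (suc n) + 1 + (v * 2 + 1) ≡ v * (4 + n) + 2
      identity = solve-∀

  copies-triple : ∀ {n} (reg : Fin n → Fin R) (p q : Fin n → ℕ) a b t {o} →
    (∀ i → reg i ≢ a) → (∀ i → reg i ≢ b) → (∀ i → reg i ≢ t) → a ≢ b → a ≢ t → b ≢ t →
    Occurs (copiesCode reg p q a b t o) o → ∀ (σ : Env R) → σ t ≡ 0 →
    Triple o (o + copiesLength p q) (_≗ σ)
      (_≗ increased σ a b (sum (λ i → p i * σ (reg i))) (sum (λ i → q i * σ (reg i))))
      (sum (λ i → σ (reg i) * (4 + (p i + q i)) + 2))
  copies-triple {zero} reg p q a b t {o} _ _ _ a≢b _ _ occ σ σt≡0 =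
    exit-at (sym (ℕP.+-identityʳ o)) (weaken-post (λ ρ≗ z → trans (ρ≗ z) (sym (unchanged z))) skip)
    where
    unchanged : increased σ a b 0 0 ≗ σ
    unchanged = ≗-split₂ a b (trans (update₂-first σ a≢b) (ℕP.+-identityʳ (σ a)))
                             (trans (update₂-second σ) (ℕP.+-identityʳ (σ b)))
                             (update₂-other σ)
  copies-triple {suc n} reg p q a b t {o} reg≢a reg≢b reg≢t a≢b a≢t b≢t occ σ σt≡0 =
    exit-at (ℕP.+-assoc o _ _)
      (weaken-cost (ℕP.≤-reflexive (cong (σ r₀ * (4 + (p₀ + q₀)) + 2 +_) (sum-cong-≗ (λ i → cong (λ v → v * _ + 2) (σ₁-reg i)))))
        (copy-triple r₀ a b t p₀ q₀ (reg≢a _) (reg≢b _) (reg≢t _) a≢b a≢t b≢t (occurs-++ˡ occ) σ σt≡0 ⨾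
         weaken-post (λ ρ≗ z → trans (ρ≗ z) (trans (cong₂ (λ u w → increased σ₁ a b u w z) (weighted (p ∘ Fin.suc)) (weighted (q ∘ Fin.suc)))
                                                 (increased-increased σ a≢b _ _ _ _ z)))
           (copies-triple (reg ∘ Fin.suc) (p ∘ Fin.suc) (q ∘ Fin.suc) a b t (reg≢a ∘ Fin.suc) (reg≢b ∘ Fin.suc) (reg≢t ∘ Fin.suc)
              a≢b a≢t b≢t (occurs-++ʳ′ (length-copyCode r₀ a b t p₀ q₀ o _) occ) σ₁ (trans (update₂-other σ (≢-sym a≢t) (≢-sym b≢t)) σt≡0))))
    where
    r₀ = reg Fin.zero
    p₀ = p Fin.zero
    q₀ = q Fin.zero
    σ₁ = increased σ a b (p₀ * σ r₀) (q₀ * σ r₀)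
    σ₁-reg : ∀ i → σ₁ (reg (Fin.suc i)) ≡ σ (reg (Fin.suc i))
    σ₁-reg i = update₂-other σ (reg≢a _) (reg≢b _)
    weighted : ∀ w → sum (λ i → w i * σ₁ (reg (Fin.suc i))) ≡ sum (λ i → w i * σ (reg (Fin.suc i)))
    weighted w = sum-cong-≗ (λ i → cong (w i *_) (σ₁-reg i))

  shift-triple : ∀ e (X : Fin (suc e) → Fin R) y {o ex} → Injective _≡_ _≡_ X → (∀ i → X i ≢ y) →
    Occurs (shiftCode e X y o ex) o → ∀ σ → σ (X Fin.zero) ≡ 0 →
    Triple o ex (_≗ σ) (Shifted X y σ) ((sum (σ ∘ X) + σ y) * 2 + suc e)
  shift-triple zero X y X-injective X≢y occ σ σX₀≡0 =
    weaken-cost (ℕP.≤-reflexive (cong (λ v → (v + 0 + σ y) * 2 + 1) (sym σX₀≡0)))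
      (weaken-post (λ ρ≗ → record
          { moved   = λ ()
          ; last    = trans (ρ≗ X₀) (moved-into-empty σ (X≢y Fin.zero) σX₀≡0)
          ; emptied = trans (ρ≗ y) (transferred-source y (X₀ ∷ []) σ)
          ; frame   = λ z∉X z≢y → trans (ρ≗ _) (moved-other σ z≢y (z∉X Fin.zero))
          })
        (transfer-triple y (X₀ ∷ []) occ (multiplicity-there [] (≢-sym (X≢y Fin.zero))) σ))
    where X₀ = X Fin.zero
  shift-triple (suc e) X y X-injective X≢y occ σ σX₀≡0 =
    weaken-cost (ℕP.≤-reflexive cost≡)
      (transfer-triple X₁ (X₀ ∷ []) (occurs-++ˡ occ) (multiplicity-there [] (X₁≢X₀ ∘ sym)) σ ⨾
       weaken-post (shifted-cons X X-injective X≢y σX₀≡0)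
         (shift-triple e (X ∘ Fin.suc) y (FinP.suc-injective ∘ X-injective) (X≢y ∘ Fin.suc) (occurs-++ʳ occ) σ₁
           (transferred-source X₁ (X₀ ∷ []) σ)))
    where
    X₀ = X Fin.zero
    X₁ = X (Fin.suc Fin.zero)
    X₁≢X₀ : X₀ ≢ X₁
    X₁≢X₀ = (λ ()) ∘ X-injective
    σ₁ = transferred X₁ (X₀ ∷ []) σ
    σ₁-later : ∀ j → σ₁ (X (Fin.suc (Fin.suc j))) ≡ σ (X (Fin.suc (Fin.suc j)))
    σ₁-later j = moved-other σ ((λ ()) ∘ X-injective) ((λ ()) ∘ X-injective)
    cost≡ : σ X₁ * 2 + 1 + ((sum (σ₁ ∘ X ∘ Fin.suc) + σ₁ y) * 2 + suc e) ≡ (sum (σ ∘ X) + σ y) * 2 + suc (suc e)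
    cost≡ = trans (cong₂ (λ u v → σ X₁ * 2 + 1 + ((u + v) * 2 + suc e))
                     (cong₂ _+_ (transferred-source X₁ (X₀ ∷ []) σ) (sum-cong-≗ σ₁-later))
                     (moved-other σ (X≢y _ ∘ sym) (X≢y _ ∘ sym)))
            (trans (identity (σ X₁) (sum (σ ∘ X ∘ Fin.suc ∘ Fin.suc)) (σ y) e)
                   (cong (λ v → (v + (σ X₁ + sum (σ ∘ X ∘ Fin.suc ∘ Fin.suc)) + σ y) * 2 + suc (suc e)) (sym σX₀≡0)))
      where
      identity : ∀ a s b e → a * 2 + 1 + ((0 + s + b) * 2 + suc e) ≡ (0 + (a + s) + b) * 2 + suc (suc e)
      identity = solve-∀

module Simulation (e : ℕ) (α : Fin (suc e) → ℚ) (s : ℕ → ℕ)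
  (recurrence : ∀ n → ℕ→ℚ (s (n + suc e)) +ℚ sumℚ (λ i → α i *ℚ ℕ→ℚ (s (n + suc e ∸ suc (toℕ i)))) ≡ 0ℚ)
  where

  open ClearedDenominators (clear-denominators α) using (denominator-1)
  open IntegerRelation (clear-denominators α) using (D; positive; negative; relation-in-ℕ)

  d = suc e

  previous : ℕ → Fin d → ℕ
  previous k i = s (k + d ∸ suc (toℕ i))

  A B : ℕ → ℕ
  A k = sum (λ i → negative i * previous k i)
  B k = sum (λ i → positive i * previous k i)

  next-balance : ∀ k → s (k + d) * D + B k ≡ A k
  next-balance k = relation-in-ℕ (s (k + d)) (previous k) (recurrence k)

  next-quotient : ∀ k → (A k ∸ B k) / D ≡ s (k + d)
  next-quotient k = trans (cong (λ a → (a ∸ B k) / D) (sym (next-balance k)))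
                          (trans (cong (_/ D) (ℕP.m+n∸n≡m (s (k + d) * D) (B k))) (DM.m*n/n≡m (s (k + d)) D))

  -- Registers: counter/output C, accumulators A and B, scratch T, next value Y, window X₀ … X_{d-1}.
  R = 5 + d
  rC rA rB rT rY : Fin R
  rC = Fin.zero
  rA = Fin.suc Fin.zero
  rB = Fin.suc (Fin.suc Fin.zero)
  rT = Fin.suc (Fin.suc (Fin.suc Fin.zero))
  rY = Fin.suc (Fin.suc (Fin.suc (Fin.suc Fin.zero)))
  rX : Fin d → Fin R
  rX i = Fin.suc (Fin.suc (Fin.suc (Fin.suc (Fin.suc i))))

  rX-injective : ∀ {i j} → rX i ≡ rX j → i ≡ j
  rX-injective refl = refl

  -- X_{d-1-i} holds s(k + d - 1 - i), the value multiplied by the i-th coefficient.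
  rPrevious : Fin d → Fin R
  rPrevious i = rX (Fin.opposite i)

  initialList : List (Fin R)
  initialList = replicates rX (λ i → s (toℕ i))

  h o₀ o₁ o₂ o₃ o₄ : ℕ
  h  = length initialList
  o₀ = suc h
  o₁ = o₀ + copiesLength negative positive
  o₂ = o₁ + 2
  o₃ = o₂ + (D + 1)
  o₄ = o₃ + 1

  bodyCode : List (Instr R)
  bodyCode = copiesCode rPrevious negative positive rA rB rT o₀ ++ subtractCode rA rB o₁ o₂ ++
             divideCode rA rY D o₂ o₃ ++ transferCode (rX Fin.zero) [] o₃ o₄ ++ shiftCode e rX rY o₄ h

  out : ℕ
  out = o₀ + length bodyCode

  outputCode loopCode program : List (Instr R)
  outputCode = transferCode (rX Fin.zero) (rC ∷ []) out (out + 2)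
  loopCode   = dec rC out o₀ ∷ bodyCode ++ outputCode
  program    = incChain initialList 0 h ++ loopCode

  open ProgramLogic program
  open Blocks program

  length-program : length program ≡ out + 2
  length-program = begin
    length program                                   ≡⟨ ListP.length-++ (incChain initialList 0 h) ⟩
    length (incChain initialList 0 h) + length loopCode ≡⟨ cong₂ _+_ (length-incChain initialList 0 h) (cong suc (ListP.length-++ bodyCode)) ⟩
    h + suc (length bodyCode + 2)                    ≡⟨ ℕP.+-suc h _ ⟩
    suc (h + (length bodyCode + 2))                  ≡⟨ cong suc (ℕP.+-assoc h (length bodyCode) 2) ⟨
    out + 2                                          ∎
    where open ≡-Reasoning

  occurs-init : Occurs (incChain initialList 0 h) 0
  occurs-init = occurs-++ˡ occurs-whole

  occurs-loop : Occurs loopCode h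
  occurs-loop = occurs-++ʳ′ (length-incChain initialList 0 h) occurs-whole

  occurs-body : Occurs bodyCode o₀
  occurs-body = occurs-++ˡ (occurs-tail occurs-loop)

  occurs-output : Occurs outputCode out
  occurs-output = occurs-++ʳ (occurs-tail occurs-loop)

  record State (k m a b y : ℕ) (ρ : Env R) : Set where
    field
      counter : ρ rC ≡ m
      regA    : ρ rA ≡ a
      regB    : ρ rB ≡ b
      regT    : ρ rT ≡ 0
      regY    : ρ rY ≡ y
      window  : ∀ i → ρ (rX i) ≡ s (k + toℕ i)
  open State

  -- The loop invariant: k steps done, m to go, auxiliary registers empty.
  Idle : ℕ → ℕ → Env R → Set
  Idle k m = State k m 0 0 0

  previous-register : ∀ {k m a b y σ} → State k m a b y σ → ∀ i → σ (rPrevious i) ≡ previous k i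
  previous-register st i = trans (window st (Fin.opposite i))
    (cong s (trans (cong (_ +_) (FinP.opposite-prop i)) (sym (ℕP.+-∸-assoc _ (FinP.toℕ<n i)))))

  copiesCost : ℕ → ℕ
  copiesCost k = sum (λ i → previous k i * (4 + (negative i + positive i)) + 2)

  copies-phase : ∀ k m → Triple o₀ o₁ (Idle k m) (State k m (A k) (B k) 0) (copiesCost k)
  copies-phase k m = generalise λ σ st →
    weaken-cost (ℕP.≤-reflexive (sum-cong-≗ (λ i → cong (λ v → v * (4 + (negative i + positive i)) + 2) (previous-register st i))))
      (weaken-post (λ ρ≗ → record
          { counter = trans (ρ≗ rC) (counter st)
          ; regA    = trans (ρ≗ rA) (cong₂ _+_ (regA st) (weighted st negative))
          ; regB    = trans (ρ≗ rB) (cong₂ _+_ (regB st) (weighted st positive))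
          ; regT    = trans (ρ≗ rT) (regT st)
          ; regY    = trans (ρ≗ rY) (regY st)
          ; window  = λ i → trans (ρ≗ (rX i)) (window st i)
          })
        (copies-triple rPrevious negative positive rA rB rT (λ _ ()) (λ _ ()) (λ _ ()) (λ ()) (λ ()) (λ ())
           (occurs-++ˡ occurs-body) σ (regT st)))
    where
    weighted : ∀ {σ} → Idle k m σ → ∀ w → sum (λ i → w i * σ (rPrevious i)) ≡ sum (λ i → w i * previous k i)
    weighted st w = sum-cong-≗ (λ i → cong (w i *_) (previous-register st i))

  occurs-after-copies : Occurs (subtractCode rA rB o₁ o₂ ++ divideCode rA rY D o₂ o₃ ++
                                transferCode (rX Fin.zero) [] o₃ o₄ ++ shiftCode e rX rY o₄ h) o₁
  occurs-after-copies = occurs-++ʳ′ (length-copiesCode rPrevious negative positive rA rB rT o₀) occurs-body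

  occurs-after-subtract : Occurs (divideCode rA rY D o₂ o₃ ++ transferCode (rX Fin.zero) [] o₃ o₄ ++ shiftCode e rX rY o₄ h) o₂
  occurs-after-subtract = occurs-++ʳ {b₁ = subtractCode rA rB o₁ o₂} occurs-after-copies

  occurs-after-divide : Occurs (transferCode (rX Fin.zero) [] o₃ o₄ ++ shiftCode e rX rY o₄ h) o₃
  occurs-after-divide = occurs-++ʳ′ (length-divideCode rA rY D o₂ o₃) occurs-after-subtract

  subtract-phase : ∀ k m → Triple o₁ o₂ (State k m (A k) (B k) 0) (State k m (A k ∸ B k) 0 0) (B k * 2 + 1)
  subtract-phase k m = generalise λ σ st →
    weaken-cost (ℕP.≤-reflexive (cong (λ b → b * 2 + 1) (regB st)))
      (weaken-post (λ ρ≗ → record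
          { counter = trans (ρ≗ rC) (counter st)
          ; regA    = trans (ρ≗ rA) (cong₂ _∸_ (regA st) (regB st))
          ; regB    = ρ≗ rB
          ; regT    = trans (ρ≗ rT) (regT st)
          ; regY    = trans (ρ≗ rY) (regY st)
          ; window  = λ i → trans (ρ≗ (rX i)) (window st i)
          })
        (subtract-triple rA rB (λ ()) (occurs-++ˡ occurs-after-copies) σ))

  divide-phase : ∀ k m → Triple o₂ o₃ (State k m (A k ∸ B k) 0 0) (State k m 0 0 (s (k + d))) (suc D * suc (A k ∸ B k))
  divide-phase k m = generalise λ σ st →
    weaken-cost (ℕP.≤-reflexive (cong (λ a → suc D * suc a) (regA st)))
      (weaken-post (λ ρ≗ → record
          { counter = trans (ρ≗ rC) (counter st)
          ; regA    = ρ≗ rA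
          ; regB    = trans (ρ≗ rB) (regB st)
          ; regT    = trans (ρ≗ rT) (regT st)
          ; regY    = trans (ρ≗ rY) (trans (cong₂ (λ y a → y + a / D) (regY st) (regA st)) (next-quotient k))
          ; window  = λ i → trans (ρ≗ (rX i)) (window st i)
          })
        (divide-triple rA rY denominator-1 (λ ()) (occurs-++ˡ {b₁ = divideCode rA rY D o₂ o₃} occurs-after-subtract) σ))

  shiftCost : ℕ → ℕ
  shiftCost k = s (k + 0) * 1 + 1 + ((sum (λ (i : Fin d) → s (k + toℕ i)) + s (k + d)) * 2 + suc e)

  shift-phase : ∀ k m → Triple o₃ h (State k m 0 0 (s (k + d))) (Idle (suc k) m) (shiftCost k)
  shift-phase k m = generalise λ σ st →
    weaken-cost (cost≤ st)
      (transfer-triple X₀ [] (occurs-++ˡ {b₁ = transferCode X₀ [] o₃ o₄} occurs-after-divide) refl σ ⨾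
       weaken-post (shifted st)
         (shift-triple e rX rY rX-injective (λ _ ()) (occurs-++ʳ {b₁ = transferCode X₀ [] o₃ o₄} occurs-after-divide)
            (transferred X₀ [] σ) (transferred-source X₀ [] σ)))
    where
    X₀ = rX Fin.zero
    kept : ∀ σ z → z ≢ X₀ → transferred X₀ [] σ z ≡ σ z
    kept σ z z≢X₀ = trans (transferred-other X₀ [] σ z≢X₀) (ℕP.+-identityʳ (σ z))
    cost≤ : ∀ {σ} → State k m 0 0 (s (k + d)) σ →
      σ X₀ * 1 + 1 + ((sum (transferred X₀ [] σ ∘ rX) + transferred X₀ [] σ rY) * 2 + suc e)
        ≤ shiftCost k
    cost≤ {σ} st = ℕP.+-mono-≤ (ℕP.≤-reflexive (cong (λ v → v * 1 + 1) (window st Fin.zero)))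
      (ℕP.+-monoˡ-≤ (suc e) (ℕP.*-monoˡ-≤ 2 (ℕP.+-mono-≤ (sum-mono-≤ window≤)
        (ℕP.≤-reflexive (trans (kept σ rY (λ ())) (regY st))))))
      where
      window≤ : ∀ i → transferred X₀ [] σ (rX i) ≤ s (k + toℕ i)
      window≤ Fin.zero    = z≤n
      window≤ (Fin.suc j) = ℕP.≤-reflexive (trans (kept σ (rX (Fin.suc j)) (λ ())) (window st (Fin.suc j)))
    shifted : ∀ {σ ρ} → State k m 0 0 (s (k + d)) σ → Shifted rX rY (transferred X₀ [] σ) ρ → Idle (suc k) m ρ
    shifted {σ} {ρ} st sh = record
      { counter = trans (frame (λ _ ()) (λ ())) (trans (kept σ rC (λ ())) (counter st))
      ; regA    = trans (frame (λ _ ()) (λ ())) (trans (kept σ rA (λ ())) (regA st))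
      ; regB    = trans (frame (λ _ ()) (λ ())) (trans (kept σ rB (λ ())) (regB st))
      ; regT    = trans (frame (λ _ ()) (λ ())) (trans (kept σ rT (λ ())) (regT st))
      ; regY    = emptied
      ; window  = window′
      }
      where
      open Shifted sh
      window′ : ∀ i → ρ (rX i) ≡ s (suc k + toℕ i)
      window′ i with last-or-inject₁ i
      ... | inj₁ refl       = trans last (trans (trans (kept σ rY (λ ())) (regY st))
                                (cong s (trans (ℕP.+-suc k e) (cong (suc ∘ (k +_)) (sym (FinP.toℕ-fromℕ e))))))
      ... | inj₂ (j , refl) = trans (moved j) (trans (trans (kept σ (rX (Fin.suc j)) (λ ())) (window st (Fin.suc j)))
                                (cong s (trans (ℕP.+-suc k (toℕ j)) (cong (suc ∘ (k +_)) (sym (FinP.toℕ-inject₁ j))))))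

  bodyCost : ℕ → ℕ
  bodyCost k = copiesCost k + (B k * 2 + 1 + (suc D * suc (A k ∸ B k) + shiftCost k))

  body-triple : ∀ k m → Triple o₀ h (Idle k m) (Idle (suc k) m) (bodyCost k)
  body-triple k m = copies-phase k m ⨾ subtract-phase k m ⨾ divide-phase k m ⨾ shift-phase k m

  loopCost : ℕ → ℕ → ℕ
  loopCost k zero    = 1
  loopCost k (suc m) = 1 + (bodyCost k + loopCost (suc k) m)

  loop-triple : ∀ m k → Triple h out (Idle k m) (Idle (k + m) 0) (loopCost k m)
  loop-triple zero    k = generalise λ σ st →
    weaken-post (λ {ρ} ρ≗ → subst (λ j → Idle j 0 ρ) (sym (ℕP.+-identityʳ k)) (record
        { counter = trans (ρ≗ rC) (counter st)
        ; regA    = trans (ρ≗ rA) (regA st)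
        ; regB    = trans (ρ≗ rB) (regB st)
        ; regT    = trans (ρ≗ rT) (regT st)
        ; regY    = trans (ρ≗ rY) (regY st)
        ; window  = λ i → trans (ρ≗ (rX i)) (window st i)
        }))
      (dec-zero-triple occurs-loop (counter st))
  loop-triple (suc m) k =
    (generalise λ σ st →
      weaken-post (λ ρ≗ → record
          { counter = ρ≗ rC
          ; regA    = trans (ρ≗ rA) (regA st)
          ; regB    = trans (ρ≗ rB) (regB st)
          ; regT    = trans (ρ≗ rT) (regT st)
          ; regY    = trans (ρ≗ rY) (regY st)
          ; window  = λ i → trans (ρ≗ (rX i)) (window st i)
          })
        (dec-suc-triple occurs-loop (counter st))) ⨾
    body-triple k m ⨾
    weaken-post (λ {ρ} → subst (λ j → Idle j 0 ρ) (sym (ℕP.+-suc k m))) (loop-triple m (suc k))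

  initialEnv : ℕ → Env R
  initialEnv n = lookup (regs (initial {4 + d} n))

  init-triple : ∀ n → Triple 0 h (_≗ initialEnv n) (Idle 0 n) h
  init-triple n =
    subst (λ o → Triple o h (_≗ initialEnv n) (Idle 0 n) h) (entry≡0 initialList)
      (weaken-post (λ ρ≗ → record
          { counter = trans (ρ≗ rC) (trans (cong (n +_) (absent (λ _ ()))) (ℕP.+-identityʳ n))
          ; regA    = trans (ρ≗ rA) (absent (λ _ ()))
          ; regB    = trans (ρ≗ rB) (absent (λ _ ()))
          ; regT    = trans (ρ≗ rT) (absent (λ _ ()))
          ; regY    = trans (ρ≗ rY) (absent (λ _ ()))
          ; window  = λ i → trans (ρ≗ (rX i)) (cong₂ _+_ (VecP.lookup-replicate i 0)
                                                        (multiplicity-replicates rX (λ i → s (toℕ i)) rX-injective i))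
          })
        (incChain-triple initialList occurs-init))
    where
    absent : ∀ {z} → (∀ i → z ≢ rX i) → multiplicity z initialList ≡ 0
    absent = multiplicity-replicates-other rX (λ i → s (toℕ i))
    entry≡0 : ∀ (ys : List (Fin R)) → chainEntry ys 0 (length ys) ≡ 0
    entry≡0 []      = refl
    entry≡0 (_ ∷ _) = refl

  output-triple : ∀ n → Triple out (out + 2) (Idle n 0) (λ ρ → ρ rC ≡ s n) (s (n + 0) * 2 + 1)
  output-triple n = generalise λ σ st →
    weaken-cost (ℕP.≤-reflexive (cong (λ v → v * 2 + 1) (window st Fin.zero)))
      (weaken-post (λ ρ≗ → trans (ρ≗ rC) (trans (moved-into-empty σ (λ ()) (counter st))
                                               (trans (window st Fin.zero) (cong s (ℕP.+-identityʳ n)))))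
        (transfer-triple X₀ (rC ∷ []) occurs-output (multiplicity-there {z = X₀} {y = rC} [] (λ ())) σ))
    where X₀ = rX Fin.zero

  totalCost : ℕ → ℕ
  totalCost n = h + (loopCost 0 n + (s (n + 0) * 2 + 1))

  run-triple : ∀ n → Triple 0 (out + 2) (_≗ initialEnv n) (λ ρ → ρ rC ≡ s n) (totalCost n)
  run-triple n = init-triple n ⨾ loop-triple n 0 ⨾ output-triple n

  G Q : ℕ
  G = suc (sum (λ (i : Fin d) → s (toℕ i)))
  Q = suc (sum negative)

  growth : ∀ m → s m ≤ G * Q ^ m
  growth = recurrence-growth s e negative next≤A
    where
    next≤A : ∀ k → s (k + d) ≤ A k
    next≤A k = ℕP.≤-trans (ℕP.m≤m*n (s (k + d)) D)
                 (ℕP.≤-trans (ℕP.m≤m+n _ (B k)) (ℕP.≤-reflexive (next-balance k)))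

  W : ℕ → ℕ
  W k = G * Q ^ (k + d)

  W-mono : ∀ {k k'} → k ≤ k' → W k ≤ W k'
  W-mono k≤k' = ℕP.*-monoʳ-≤ G (ℕP.^-monoʳ-≤ Q (ℕP.+-monoˡ-≤ d k≤k'))

  early≤W : ∀ k {m} → m ≤ k + d → s m ≤ W k
  early≤W k m≤ = ℕP.≤-trans (growth _) (ℕP.*-monoʳ-≤ G (ℕP.^-monoʳ-≤ Q m≤))

  window≤W : ∀ k {j} → j ≤ d → s (k + j) ≤ W k
  window≤W k j≤d = early≤W k (ℕP.+-monoʳ-≤ k j≤d)

  previous≤W : ∀ k i → previous k i ≤ W k
  previous≤W k i = early≤W k (ℕP.m∸n≤m (k + d) (suc (toℕ i)))

  weighted≤W : ∀ k (w : Fin d → ℕ) → sum (λ i → w i * previous k i) ≤ sum w * W k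
  weighted≤W k w = ℕP.≤-trans (sum-mono-≤ (λ i → ℕP.*-monoʳ-≤ (w i) (previous≤W k i)))
                              (ℕP.≤-reflexive (sym (*-distribʳ-sum (W k) w)))

  bodyConstant : ℕ
  bodyConstant = sum (λ i → 1 * (4 + (negative i + positive i)) + 2) +
                 (sum positive * 2 + 1 + (sum negative * suc D + suc D + (1 * 1 + 1 + (suc d * 2 + suc e))))

  body≤ : ∀ k → bodyCost k ≤ (W k + 1) * bodyConstant
  body≤ k = ℕP.≤-trans
    (ℕP.+-mono-≤ copies≤ (ℕP.+-mono-≤ (affine≤ {c = sum positive} {w = W k} 2 1 (weighted≤W k positive))
      (ℕP.+-mono-≤ divide≤ (ℕP.+-mono-≤ (affine≤ {c = 1} {w = W k} 1 1 (≤1*W (window≤W k z≤n))) shift≤))))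
    (ℕP.≤-reflexive (distribute (W k + 1) _ _ _ _ _))
    where
    ≤1*W : ∀ {x} → x ≤ W k → x ≤ 1 * W k
    ≤1*W {x} x≤W = subst (x ≤_) (sym (ℕP.*-identityˡ (W k))) x≤W
    copies≤ : copiesCost k ≤ (W k + 1) * sum (λ i → 1 * (4 + (negative i + positive i)) + 2)
    copies≤ = ℕP.≤-trans (sum-mono-≤ (λ i → affine≤ {c = 1} {w = W k} (4 + (negative i + positive i)) 2 (≤1*W (previous≤W k i))))
                         (ℕP.≤-reflexive (sym (*-distribˡ-sum (W k + 1) (λ i → 1 * (4 + (negative i + positive i)) + 2))))
    divide≤ : suc D * suc (A k ∸ B k) ≤ (W k + 1) * (sum negative * suc D + suc D)
    divide≤ = subst (_≤ (W k + 1) * (sum negative * suc D + suc D))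
                (trans (ℕP.+-comm ((A k ∸ B k) * suc D) (suc D)) (sym (trans (ℕP.*-suc (suc D) (A k ∸ B k)) (cong (suc D +_) (ℕP.*-comm (suc D) (A k ∸ B k))))))
                (affine≤ {c = sum negative} {w = W k} (suc D) (suc D) (ℕP.≤-trans (ℕP.m∸n≤m (A k) (B k)) (weighted≤W k negative)))
    shift≤ : (sum (λ (i : Fin d) → s (k + toℕ i)) + s (k + d)) * 2 + suc e ≤ (W k + 1) * (suc d * 2 + suc e)
    shift≤ = affine≤ {c = suc d} {w = W k} 2 (suc e) (ℕP.≤-trans
      (ℕP.+-mono-≤ (ℕP.≤-trans (sum-mono-≤ (λ i → window≤W k (ℕP.<⇒≤ (FinP.toℕ<n i)))) (ℕP.≤-reflexive (sum-const d (W k))))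
                   (window≤W k ℕP.≤-refl))
      (ℕP.≤-reflexive (ℕP.+-comm (d * W k) (W k))))
    distribute : ∀ w a b c x y → w * a + (w * b + (w * c + (w * x + w * y))) ≡ w * (a + (b + (c + (x + y))))
    distribute = solve-∀

  loop≤ : ∀ m k → loopCost k m ≤ suc m * (1 + (W (k + m) + 1) * bodyConstant)
  loop≤ zero    k = s≤s z≤n
  loop≤ (suc m) k = s≤s (ℕP.+-mono-≤ body≤′ (subst (λ j → loopCost (suc k) m ≤ suc m * (1 + (W j + 1) * bodyConstant))
                                                    (sym (ℕP.+-suc k m)) (loop≤ m (suc k))))
    where
    body≤′ : bodyCost k ≤ (W (k + suc m) + 1) * bodyConstant
    body≤′ = ℕP.≤-trans (body≤ k) (ℕP.*-monoˡ-≤ bodyConstant (ℕP.+-monoˡ-≤ 1 (W-mono (ℕP.m≤m+n k (suc m)))))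

  heightOfTower : ℕ
  heightOfTower = suc (suc Q + (h + 2 + Z * bodyConstant + bodyConstant + Z * 2))
    where Z = G * Q ^ d

  total≤tower : ∀ n → totalCost n ≤ tower heightOfTower n
  total≤tower n = begin
    totalCost n
      ≤⟨ ℕP.+-monoʳ-≤ h (ℕP.+-mono-≤ (loop≤ n 0) (ℕP.+-monoˡ-≤ 1 (ℕP.*-monoˡ-≤ 2 (window≤W n z≤n)))) ⟩
    h + (suc n * (1 + (W n + 1) * K) + (W n * 2 + 1))
      ≡⟨ cong (λ w → h + (suc n * (1 + (w + 1) * K) + (w * 2 + 1))) W≡Z*Qⁿ ⟩
    h + (suc n * (1 + (Z * Q ^ n + 1) * K) + (Z * Q ^ n * 2 + 1))
      ≤⟨ collect h Z K n (Q ^ n) (ℕP.m^n>0 Q n) ⟩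
    C * (suc n * Q ^ n)
      ≤⟨ poly*exp≤tower C Q n ⟩
    tower heightOfTower n ∎
    where
    open ℕP.≤-Reasoning
    K = bodyConstant
    Z = G * Q ^ d
    C = h + 2 + Z * K + K + Z * 2
    W≡Z*Qⁿ : W n ≡ Z * Q ^ n
    W≡Z*Qⁿ = trans (cong (G *_) (ℕP.^-distribˡ-+-* Q n d)) (rearrange G (Q ^ n) (Q ^ d))
      where
      rearrange : ∀ g a b → g * (a * b) ≡ g * b * a
      rearrange = solve-∀
    collect : ∀ h Z K n u → 1 ≤ u →
      h + (suc n * (1 + (Z * u + 1) * K) + (Z * u * 2 + 1)) ≤ (h + 2 + Z * K + K + Z * 2) * (suc n * u)
    collect h Z K n (suc u) _ = ℕP.≤-trans (ℕP.m≤m+n _ surplus) (ℕP.≤-reflexive (identity h Z K n u))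
      where
      surplus = h * (n + u + n * u) + (n + 2 * u + 2 * n * u) + K * (u + n * u) + Z * 2 * (n + n * u)
      identity : ∀ h Z K n u →
        h + (suc n * (1 + (Z * suc u + 1) * K) + (Z * suc u * 2 + 1)) +
        (h * (n + u + n * u) + (n + 2 * u + 2 * n * u) + K * (u + n * u) + Z * 2 * (n + n * u))
        ≡ (h + 2 + Z * K + K + Z * 2) * (suc n * suc u)
      identity = solve-∀

  kalmar : Kalmar s
  kalmar = 4 + d , length program , P , heightOfTower , λ n → halting n (runs (run-triple n) (regs (initial n)) (λ _ → refl))
    where
    halting : ∀ n → Σ (Vec ℕ R) (λ v → Reaches (initial n) (totalCost n) ⟨ out + 2 , v ⟩ × lookup v rC ≡ s n) →
              Σ ℕ λ t → (t ≤ tower heightOfTower n) × Halted P (run P t (initial n)) × (output (run P t (initial n)) ≡ s n)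
    halting n (v , (t , t≤ , ran) , output≡) =
      t , ℕP.≤-trans t≤ (total≤tower n) , subst (Halted P) (sym ran) (ℕP.≤-reflexive length-program) , trans (cong output ran) output≡

theorem5p3 : (s : ℕ → ℕ) → CRecursive s → Kalmar s
theorem5p3 s (e , α , _ , recurrence) = Simulation.kalmar e α s recurrence
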